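{- Let $k\in\mathbb{Z}$. Then for every permutation $\tau$, $$\mathrm{exc}_k(\tau)=\sum_{\pi\in\mathfrak{S}}\Big((-1)^{|\pi|-k-1}\sum_{x\in\mathrm{SSF}(\pi)}\binom{|\pi|-1}{x-k-1}\Big)\pi(\tau).$$ In particular, for every $\tau$, $$\mathrm{fix}(\tau)=\sum_{\pi}\Big((-1)^{|\pi|-1}\sum_{x\in\mathrm{SSF}(\pi)}\binom{|\pi|-1}{x-1}\Big)\pi(\tau),\qquad \mathrm{exc}(\tau)=\sum_{\pi}\Big((-1)^{|\pi|-2}\sum_{x\in\mathrm{SSF}(\pi)}\binom{|\pi|-2}{x-2}\Big)\pi(\tau).$$
   Context: $\mathfrak{S}$ is the set of all permutations of $[1,n]$, $n\ge0$; $\pi(\tau)$ is the number of classical occurrences of $\pi$ in $\tau$ (subsequences order-isomorphic to $\pi$). For $\pi\in\mathfrak{S}_n$ and a value $x=\pi(j)$, the excess of $x$ is $x-j$. $\mathrm{exc}_k(\pi)$ is the number of values $x$ of $\pi$ with excess $k$; $\mathrm{fix}(\pi)=\mathrm{exc}_0(\pi)$ is the number of fixed points; $\mathrm{exc}(\pi)$ is the number of values with positive excess (excedance tops). A value $x=\pi(j)$ is a skew strong fixed point if $\pi(i)>x$ for all $i<j$ and $\pi(i)<x$ for all $i>j$; $\mathrm{SSF}(\pi)$ is the set of skew strong fixed points (as values). Binomial convention: $\binom{a}{b}=0$ whenever $b<0$ or $b>a$. -}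

module Defs where

open import Data.Nat as ℕ using (ℕ; zero; suc; _∸_; _≤_; _<_; _<?_; _≤?_)
open import Data.Nat.Combinatorics using (_C_)
open import Data.Integer as ℤ using (ℤ; +_; -[1+_]; _-_; ∣_∣) renaming (_+_ to _+ℤ_; _*_ to _*ℤ_)
open import Data.List using (List; []; _∷_; _++_; map; filter; length; upTo; zip; take; drop; concatMap; foldr)
open import Data.List.Properties using (≡-dec)
open import Data.List.Relation.Unary.All using (All; all?)
open import Data.List.Relation.Unary.Unique.Propositional using (Unique)
open import Data.List.Relation.Unary.Unique.DecPropositional ℕ._≟_ using (unique?)
open import Data.Product using (_×_; _,_; proj₁; proj₂)
open import Relation.Nullary using (Dec)
open import Relation.Nullary.Decidable using (_×-dec_)

-- Permutations of [1,n] are represented as lists of naturals in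
-- one-line notation: τ = [τ(1), …, τ(n)].

IsPerm : List ℕ → Set
IsPerm l = Unique l × All (λ x → 1 ≤ x × x ≤ length l) l

isPerm? : (l : List ℕ) → Dec (IsPerm l)
isPerm? l = unique? l ×-dec all? (λ x → (1 ≤? x) ×-dec (x ≤? length l)) l

range1 : ℕ → List ℕ
range1 n = map suc (upTo n)

words : ℕ → List ℕ → List (List ℕ)
words zero      vs = [] ∷ []
words (suc m)   vs = concatMap (λ v → map (v ∷_) (words m vs)) vs

perms : ℕ → List (List ℕ)
perms m = filter isPerm? (words m (range1 m))

subseqs : ℕ → List ℕ → List (List ℕ)
subseqs zero    _        = [] ∷ []
subseqs (suc m) []       = []
subseqs (suc m) (x ∷ xs) = map (x ∷_) (subseqs m xs) ++ subseqs (suc m) xs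

-- standardization (reduction) of a word: each entry x is replaced by
-- 1 + #{entries smaller than x}; for words with distinct entries, this is
-- the unique permutation order-isomorphic to it.
st : List ℕ → List ℕ
st l = map (λ x → suc (length (filter (_<? x) l))) l

-- π(τ): number of occurrences of the pattern π in τ
occ : List ℕ → List ℕ → ℕ
occ π τ = length (filter (λ s → ≡-dec ℕ._≟_ (st s) π) (subseqs (length π) τ))

-- pairs (j , π(j)) with 1-based positions j
indexed : List ℕ → List (ℕ × ℕ)
indexed π = zip (range1 (length π)) π

excK : ℤ → List ℕ → ℕ
excK k π = length (filter (λ p → (+ proj₂ p) - (+ proj₁ p) ℤ.≟ k) (indexed π))

fix : List ℕ → ℕ
fix π = length (filter (λ p → proj₂ p ℕ.≟ proj₁ p) (indexed π))

exc : List ℕ → ℕ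
exc π = length (filter (λ p → proj₁ p <? proj₂ p) (indexed π))

IsSSF : List ℕ → ℕ × ℕ → Set
IsSSF π (j , x) = All (x <_) (take (j ∸ 1) π) × All (_< x) (drop j π)

isSSF? : (π : List ℕ) → (p : ℕ × ℕ) → Dec (IsSSF π p)
isSSF? π (j , x) = all? (x <?_) (take (j ∸ 1) π) ×-dec all? (_<? x) (drop j π)

SSF : List ℕ → List ℕ
SSF π = map proj₂ (filter (isSSF? π) (indexed π))

sumℤ : List ℤ → ℤ
sumℤ = foldr _+ℤ_ (+ 0)

-- (-1)^e for e : ℤ (depends only on the parity of e)
negOnePowℕ : ℕ → ℤ
negOnePowℕ zero    = + 1
negOnePowℕ (suc n) = ℤ.- negOnePowℕ n

negOnePow : ℤ → ℤ
negOnePow e = negOnePowℕ ∣ e ∣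

-- binomial coefficient with integer arguments, 0 if b < 0 or b > a
-- (stdlib's n C k is already 0 when k > n; a < 0 forces b > a or b < 0)
binomℤ : ℤ → ℤ → ℤ
binomℤ (+ a)    (+ b)    = + (a C b)
binomℤ (+ a)    -[1+ _ ] = + 0
binomℤ -[1+ _ ] _        = + 0

sumPermsUpTo : ℕ → (List ℕ → ℤ) → ℤ
sumPermsUpTo N f = sumℤ (map (λ m → sumℤ (map f (perms m))) (upTo (suc N)))

coeffExcK : ℤ → List ℕ → ℤ
coeffExcK k π =
  negOnePow (+ length π - k - + 1)
  *ℤ sumℤ (map (λ x → binomℤ (+ length π - + 1) (+ x - k - + 1)) (SSF π))

coeffFix : List ℕ → ℤ
coeffFix π =
  negOnePow (+ length π - + 1)
  *ℤ sumℤ (map (λ x → binomℤ (+ length π - + 1) (+ x - + 1)) (SSF π))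

coeffExc : List ℕ → ℤ
coeffExc π =
  negOnePow (+ length π - + 2)
  *ℤ sumℤ (map (λ x → binomℤ (+ length π - + 2) (+ x - + 2)) (SSF π))

-- Σ_π c(π)·π(τ) = Σ_{s ⊆ τ} c(st s), a sum over all subsequences s of τ.  Each coefficient has
-- the form c(π) = Σ w(i, l) over the skew strong fixed points x of π, with i, l the numbers of
-- letters left and right of x; x = l + 1 as π is a permutation.  Standardization keeps relative
-- order, so the skew strong fixed points of st s are the letters y of s exceeding everything
-- before them in s and exceeded by everything after them.  Exchanging the sums, a letter y of
-- τ at position j contributes Σ_{i,l} C(a,i)·C(b,l)·w(i,l), where a counts the larger letters
-- left of y and b the smaller letters right of y; for a permutation τ, b − a = y − j is the
-- excess of y.  By Pascal's rule in each variable this double sum is [b − a = k] for the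
-- weights of exc_k, and [b − a ≥ 1] for those of exc; fix is exc_0.

module Submission where

open import Defs
open import Data.Nat using (ℕ; _≤_)
open import Data.Integer using (ℤ; +_) renaming (_*_ to _*ℤ_)
open import Data.List using (List; length)
open import Data.Product using (_×_)
open import Relation.Binary.PropositionalEquality using (_≡_)

open import Data.Bool using (true; false)
open import Data.Empty using (⊥-elim)
open import Data.Integer as ℤ using (_+_; _-_; -_; _*_; -[1+_])
import Data.Integer.Properties as ℤ
open import Data.Integer.Tactic.RingSolver using (solve-∀)
open import Data.List using ([]; _∷_; _++_; map; filter; upTo; applyUpTo; zip; take; drop; concatMap)
import Data.List.Properties as List
open import Data.List.Properties using (≡-dec)
open import Data.List.Membership.Propositional using (_∈_)
import Data.List.Membership.Propositional.Properties as Membership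
open import Data.List.Relation.Unary.All as All using (All; []; _∷_)
import Data.List.Relation.Unary.All.Properties as AllP
open import Data.List.Relation.Unary.AllPairs using ([]; _∷_)
open import Data.List.Relation.Unary.Any as Any using (here; there)
open import Data.List.Relation.Unary.Unique.Propositional using (Unique)
import Data.List.Relation.Unary.Unique.Propositional.Properties as UniqueP
open import Data.Nat using (zero; suc; z≤n; s≤s; _<_; _∸_; _<?_)
import Data.Nat as ℕ
import Data.Nat.Properties as ℕ
open import Data.Nat.Combinatorics using (_C_; nCk+nC[k+1]≡[n+1]C[k+1])
open import Data.Product using (_,_; proj₁; proj₂)
open import Relation.Binary.Definitions using (tri<; tri≈; tri>)
open import Relation.Binary.PropositionalEquality
  using (_≢_; refl; sym; trans; cong; cong₂; subst; module ≡-Reasoning)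
open import Relation.Nullary using (Dec; yes; no; does; ¬_)
open import Relation.Nullary.Decidable using (_×-dec_)
open import Relation.Unary.Properties using (∁?)

private
  variable
    A B : Set

-- Indicators and finite sums over lists

𝟙 : ∀ {P : Set} → Dec P → ℤ
𝟙 (yes _) = + 1
𝟙 (no _)  = + 0

𝟙-yes : ∀ {P : Set} (P? : Dec P) → P → 𝟙 P? ≡ + 1
𝟙-yes (yes _) _  = refl
𝟙-yes (no ¬p) p = ⊥-elim (¬p p)

𝟙-no : ∀ {P : Set} (P? : Dec P) → ¬ P → 𝟙 P? ≡ + 0
𝟙-no (yes p) ¬p = ⊥-elim (¬p p)
𝟙-no (no _)  _  = refl

𝟙-⇔ : ∀ {P Q : Set} (P? : Dec P) (Q? : Dec Q) → (P → Q) → (Q → P) → 𝟙 P? ≡ 𝟙 Q?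
𝟙-⇔ (yes p) Q? to from = sym (𝟙-yes Q? (to p))
𝟙-⇔ (no ¬p) Q? to from = sym (𝟙-no Q? (λ q → ¬p (from q)))

𝟙-× : ∀ {P Q : Set} (P? : Dec P) (Q? : Dec Q) → 𝟙 (P? ×-dec Q?) ≡ 𝟙 P? * 𝟙 Q?
𝟙-× (yes p) (yes q) = refl
𝟙-× (yes p) (no ¬q) = refl
𝟙-× (no ¬p) Q?      = refl

∑ : ∀ {A : Set} → List A → (A → ℤ) → ℤ
∑ []       f = + 0
∑ (x ∷ xs) f = f x + ∑ xs f

syntax ∑ xs (λ x → e) = ∑[ x ∈ xs ] e

sumℤ-map : ∀ (f : A → ℤ) xs → sumℤ (map f xs) ≡ ∑ xs f
sumℤ-map f []       = refl
sumℤ-map f (x ∷ xs) = cong (_+_ (f x)) (sumℤ-map f xs)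

∑-cong : ∀ xs {f g : A → ℤ} → (∀ x → f x ≡ g x) → ∑ xs f ≡ ∑ xs g
∑-cong []       f≗g = refl
∑-cong (x ∷ xs) f≗g = cong₂ _+_ (f≗g x) (∑-cong xs f≗g)

∑-cong-All : ∀ {xs} {f g : A → ℤ} → All (λ x → f x ≡ g x) xs → ∑ xs f ≡ ∑ xs g
∑-cong-All []            = refl
∑-cong-All (fx≡gx ∷ eqs) = cong₂ _+_ fx≡gx (∑-cong-All eqs)

∑-zero : ∀ xs {f : A → ℤ} → (∀ x → f x ≡ + 0) → ∑ xs f ≡ + 0
∑-zero []       f≗0 = refl
∑-zero (x ∷ xs) f≗0 = cong₂ _+_ (f≗0 x) (∑-zero xs f≗0)

∑-++ : ∀ xs ys (f : A → ℤ) → ∑ (xs ++ ys) f ≡ ∑ xs f + ∑ ys f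
∑-++ []       ys f = sym (ℤ.+-identityˡ _)
∑-++ (x ∷ xs) ys f = trans (cong (_+_ (f x)) (∑-++ xs ys f)) (sym (ℤ.+-assoc (f x) _ _))

∑-+ : ∀ xs (f g : A → ℤ) → ∑[ x ∈ xs ] (f x + g x) ≡ ∑ xs f + ∑ xs g
∑-+ []       f g = refl
∑-+ (x ∷ xs) f g = trans (cong (_+_ (f x + g x)) (∑-+ xs f g)) (interchange (f x) (g x) _ _)
  where
  interchange : ∀ a b c d → (a + b) + (c + d) ≡ (a + c) + (b + d)
  interchange = solve-∀

∑-*ˡ : ∀ c xs (f : A → ℤ) → ∑[ x ∈ xs ] (c * f x) ≡ c * ∑ xs f
∑-*ˡ c []       f = sym (ℤ.*-zeroʳ c)
∑-*ˡ c (x ∷ xs) f = trans (cong (_+_ (c * f x)) (∑-*ˡ c xs f)) (sym (ℤ.*-distribˡ-+ c (f x) _))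

∑-filter : ∀ {P : A → Set} (P? : ∀ x → Dec (P x)) xs (f : A → ℤ) →
           ∑ (filter P? xs) f ≡ ∑[ x ∈ xs ] (𝟙 (P? x) * f x)
∑-filter P? []       f = refl
∑-filter P? (x ∷ xs) f with P? x
... | yes _ = cong₂ _+_ (sym (ℤ.*-identityˡ (f x))) (∑-filter P? xs f)
... | no _  = trans (∑-filter P? xs f) (sym (ℤ.+-identityˡ _))

length-filter≡∑𝟙 : ∀ {P : A → Set} (P? : ∀ x → Dec (P x)) xs →
                    + length (filter P? xs) ≡ ∑[ x ∈ xs ] 𝟙 (P? x)
length-filter≡∑𝟙 P? []       = refl
length-filter≡∑𝟙 P? (x ∷ xs) with P? x
... | yes _ = trans (ℤ.pos-+ 1 _) (cong (_+_ (+ 1)) (length-filter≡∑𝟙 P? xs))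
... | no _  = trans (length-filter≡∑𝟙 P? xs) (sym (ℤ.+-identityˡ _))

∑-map : ∀ (g : A → B) xs (f : B → ℤ) → ∑ (map g xs) f ≡ ∑[ x ∈ xs ] f (g x)
∑-map g []       f = refl
∑-map g (x ∷ xs) f = cong (_+_ (f (g x))) (∑-map g xs f)

∑-concatMap : ∀ (g : A → List B) xs (f : B → ℤ) →
              ∑ (concatMap g xs) f ≡ ∑[ x ∈ xs ] ∑ (g x) f
∑-concatMap g []       f = refl
∑-concatMap g (x ∷ xs) f =
  trans (∑-++ (g x) (concatMap g xs) f) (cong (_+_ (∑ (g x) f)) (∑-concatMap g xs f))

∑-comm : ∀ xs (ys : List B) (f : A → B → ℤ) →
           ∑[ x ∈ xs ] ∑[ y ∈ ys ] f x y ≡ ∑[ y ∈ ys ] ∑[ x ∈ xs ] f x y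
∑-comm []       ys f = sym (∑-zero ys (λ _ → refl))
∑-comm (x ∷ xs) ys f =
  trans (cong (_+_ (∑ ys (f x))) (∑-comm xs ys f)) (sym (∑-+ ys (f x) (λ y → ∑[ x ∈ xs ] f x y)))

sublists : List A → List (List A)
sublists []       = [] ∷ []
sublists (x ∷ xs) = map (x ∷_) (sublists xs) ++ sublists xs

∑-sublists-∷ : ∀ (x : A) xs (f : List A → ℤ) →
               ∑ (sublists (x ∷ xs)) f ≡ ∑[ s ∈ sublists xs ] f (x ∷ s) + ∑ (sublists xs) f
∑-sublists-∷ x xs f =
  trans (∑-++ (map (x ∷_) (sublists xs)) (sublists xs) f)
        (cong (_+ ∑ (sublists xs) f) (∑-map (x ∷_) (sublists xs) f))

∑-sublists-All : ∀ {P : A → Set} (P? : ∀ x → Dec (P x)) l (f : List A → ℤ) →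
                 ∑[ s ∈ sublists l ] (𝟙 (All.all? P? s) * f s) ≡ ∑ (sublists (filter P? l)) f
∑-sublists-All P? []      f = cong (_+ + 0) (ℤ.*-identityˡ (f []))
∑-sublists-All P? (x ∷ l) f with P? x
... | yes px = begin
  ∑[ s ∈ sublists (x ∷ l) ] (𝟙 (All.all? P? s) * f s)
    ≡⟨ ∑-sublists-∷ x l _ ⟩
  ∑[ s ∈ sublists l ] (𝟙 (All.all? P? (x ∷ s)) * f (x ∷ s)) + ∑[ s ∈ sublists l ] (𝟙 (All.all? P? s) * f s)
    ≡⟨ cong (_+ _) (∑-cong (sublists l) (λ s → cong (_* f (x ∷ s))
                      (𝟙-⇔ (All.all? P? (x ∷ s)) (All.all? P? s) All.tail (px ∷_)))) ⟩
  ∑[ s ∈ sublists l ] (𝟙 (All.all? P? s) * f (x ∷ s)) + ∑[ s ∈ sublists l ] (𝟙 (All.all? P? s) * f s)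
    ≡⟨ cong₂ _+_ (∑-sublists-All P? l (λ s → f (x ∷ s))) (∑-sublists-All P? l f) ⟩
  ∑[ s ∈ sublists (filter P? l) ] f (x ∷ s) + ∑ (sublists (filter P? l)) f
    ≡⟨ ∑-sublists-∷ x (filter P? l) f ⟨
  ∑ (sublists (x ∷ filter P? l)) f ∎
  where open ≡-Reasoning
... | no ¬px = begin
  ∑[ s ∈ sublists (x ∷ l) ] (𝟙 (All.all? P? s) * f s)
    ≡⟨ ∑-sublists-∷ x l _ ⟩
  ∑[ s ∈ sublists l ] (𝟙 (All.all? P? (x ∷ s)) * f (x ∷ s)) + ∑[ s ∈ sublists l ] (𝟙 (All.all? P? s) * f s)
    ≡⟨ cong (_+ _) (∑-zero (sublists l) (λ s → cong (_* f (x ∷ s))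
                      (𝟙-no (All.all? P? (x ∷ s)) (λ { (px ∷ _) → ¬px px })))) ⟩
  + 0 + ∑[ s ∈ sublists l ] (𝟙 (All.all? P? s) * f s)
    ≡⟨ ℤ.+-identityˡ _ ⟩
  ∑[ s ∈ sublists l ] (𝟙 (All.all? P? s) * f s)
    ≡⟨ ∑-sublists-All P? l f ⟩
  ∑ (sublists (filter P? l)) f ∎
  where open ≡-Reasoning

-- Splitting a word at one of its letters

record Split : Set where
  constructor _⟨_⟩_
  field
    left  : List ℕ
    pivot : ℕ
    right : List ℕ

open Split

consˡ : ℕ → Split → Split
consˡ t (L ⟨ y ⟩ R) = (t ∷ L) ⟨ y ⟩ R

splits : List ℕ → List Split
splits []      = []
splits (t ∷ τ) = [] ⟨ t ⟩ τ ∷ map (consˡ t) (splits τ)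

splits-join : ∀ τ → All (λ T → left T ++ pivot T ∷ right T ≡ τ) (splits τ)
splits-join []      = []
splits-join (t ∷ τ) = refl ∷ AllP.map⁺ (All.map (cong (t ∷_)) (splits-join τ))

∑-splits-cong : ∀ τ {f g : Split → ℤ} →
                (∀ L y R → L ++ y ∷ R ≡ τ → f (L ⟨ y ⟩ R) ≡ g (L ⟨ y ⟩ R)) →
                ∑ (splits τ) f ≡ ∑ (splits τ) g
∑-splits-cong τ f≗g = ∑-cong-All (All.map (λ {T} → f≗g (left T) (pivot T) (right T)) (splits-join τ))

mapSplit : (ℕ → ℕ) → Split → Split
mapSplit f (L ⟨ y ⟩ R) = map f L ⟨ f y ⟩ map f R

splits-map : ∀ f τ → splits (map f τ) ≡ map (mapSplit f) (splits τ)
splits-map f []      = refl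
splits-map f (t ∷ τ) = cong ([] ⟨ f t ⟩ map f τ ∷_) (begin
  map (consˡ (f t)) (splits (map f τ))               ≡⟨ cong (map (consˡ (f t))) (splits-map f τ) ⟩
  map (consˡ (f t)) (map (mapSplit f) (splits τ))     ≡⟨ List.map-∘ (splits τ) ⟨
  map (λ T → consˡ (f t) (mapSplit f T)) (splits τ)   ≡⟨ List.map-∘ (splits τ) ⟩
  map (mapSplit f) (map (consˡ t) (splits τ))         ∎)
  where open ≡-Reasoning

∑-splits-∷ : ∀ t s (f : Split → ℤ) → ∑ (splits (t ∷ s)) f ≡ f ([] ⟨ t ⟩ s) + ∑[ T ∈ splits s ] f (consˡ t T)
∑-splits-∷ t s f = cong (_+_ (f ([] ⟨ t ⟩ s))) (∑-map (consˡ t) (splits s) f)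

position : Split → ℕ × ℕ
position T = suc (length (left T)) , pivot T

zip-applyUpTo-splits : ∀ (f : ℕ → ℕ) τ →
  zip (applyUpTo f (length τ)) τ ≡ map (λ T → f (length (left T)) , pivot T) (splits τ)
zip-applyUpTo-splits f []      = refl
zip-applyUpTo-splits f (t ∷ τ) =
  cong ((f 0 , t) ∷_) (trans (zip-applyUpTo-splits (λ n → f (suc n)) τ) (List.map-∘ (splits τ)))

indexed≡map-position : ∀ π → indexed π ≡ map position (splits π)
indexed≡map-position π =
  trans (cong (λ is → zip is π) (List.map-upTo suc (length π))) (zip-applyUpTo-splits suc π)

∑-indexed : ∀ π (f : ℕ × ℕ → ℤ) → ∑ (indexed π) f ≡ ∑[ T ∈ splits π ] f (position T)
∑-indexed π f = trans (cong (λ ps → ∑ ps f) (indexed≡map-position π)) (∑-map position (splits π) f)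

length-filter-indexed : ∀ π {P : ℕ × ℕ → Set} (P? : ∀ p → Dec (P p)) →
                        + length (filter P? (indexed π)) ≡ ∑[ T ∈ splits π ] 𝟙 (P? (position T))
length-filter-indexed π P? =
  trans (length-filter≡∑𝟙 P? (indexed π)) (∑-indexed π (λ p → 𝟙 (P? p)))

-- Skew strong fixed points as splits

IsSSFSplit : Split → Set
IsSSFSplit (L ⟨ y ⟩ R) = All (y <_) L × All (_< y) R

isSSFSplit? : ∀ T → Dec (IsSSFSplit T)
isSSFSplit? (L ⟨ y ⟩ R) = All.all? (y <?_) L ×-dec All.all? (_<? y) R

take-length-++ : ∀ (L X : List ℕ) → take (length L) (L ++ X) ≡ L
take-length-++ []      X = refl
take-length-++ (x ∷ L) X = cong (x ∷_) (take-length-++ L X)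

drop-suc-length-++ : ∀ L (y : ℕ) R → drop (suc (length L)) (L ++ y ∷ R) ≡ R
drop-suc-length-++ []      y R = refl
drop-suc-length-++ (x ∷ L) y R = drop-suc-length-++ L y R

𝟙-isSSF?-position : ∀ L y R →
  𝟙 (isSSF? (L ++ y ∷ R) (position (L ⟨ y ⟩ R))) ≡ 𝟙 (isSSFSplit? (L ⟨ y ⟩ R))
𝟙-isSSF?-position L y R =
  cong₂ (λ L′ R′ → 𝟙 (All.all? (y <?_) L′ ×-dec All.all? (_<? y) R′))
        (take-length-++ L (y ∷ R)) (drop-suc-length-++ L y R)

sumℤ-SSF : ∀ π (g : ℕ → ℤ) → sumℤ (map g (SSF π)) ≡ ∑[ T ∈ splits π ] (𝟙 (isSSFSplit? T) * g (pivot T))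
sumℤ-SSF π g = begin
  sumℤ (map g (SSF π))
    ≡⟨ sumℤ-map g (SSF π) ⟩
  ∑ (map proj₂ ssf-entries) g
    ≡⟨ ∑-map proj₂ ssf-entries g ⟩
  ∑[ p ∈ ssf-entries ] g (proj₂ p)
    ≡⟨ ∑-filter (isSSF? π) (indexed π) (λ p → g (proj₂ p)) ⟩
  ∑[ p ∈ indexed π ] (𝟙 (isSSF? π p) * g (proj₂ p))
    ≡⟨ ∑-indexed π _ ⟩
  ∑[ T ∈ splits π ] (𝟙 (isSSF? π (position T)) * g (pivot T))
    ≡⟨ ∑-splits-cong π at-split ⟩
  ∑[ T ∈ splits π ] (𝟙 (isSSFSplit? T) * g (pivot T)) ∎
  where
  ssf-entries = filter (isSSF? π) (indexed π)
  open ≡-Reasoning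
  at-split : ∀ L y R → L ++ y ∷ R ≡ π →
             𝟙 (isSSF? π (position (L ⟨ y ⟩ R))) * g y ≡ 𝟙 (isSSFSplit? (L ⟨ y ⟩ R)) * g y
  at-split L y R refl = cong (_* g y) (𝟙-isSSF?-position L y R)

ssfWeight : (ℕ → ℕ → ℤ) → List ℕ → ℤ
ssfWeight w π = ∑[ T ∈ splits π ] (𝟙 (isSSFSplit? T) * w (length (left T)) (length (right T)))

-- Ranks and standardization

countBelow : ℕ → List ℕ → ℕ
countBelow a s = length (filter (_<? a) s)

-- st s  is  map (rank s) s  by definition.
rank : List ℕ → ℕ → ℕ
rank s x = suc (countBelow x s)

countBelow-++ : ∀ a xs ys → countBelow a (xs ++ ys) ≡ countBelow a xs ℕ.+ countBelow a ys
countBelow-++ a xs ys = trans (cong length (List.filter-++ (_<? a) xs ys)) (List.length-++ (filter (_<? a) xs))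

countBelow-∷-< : ∀ {a x} s → x < a → countBelow a (x ∷ s) ≡ suc (countBelow a s)
countBelow-∷-< {a} s x<a = cong length (List.filter-accept (_<? a) x<a)

countBelow-∷-≮ : ∀ {a x} s → ¬ x < a → countBelow a (x ∷ s) ≡ countBelow a s
countBelow-∷-≮ {a} s x≮a = cong length (List.filter-reject (_<? a) x≮a)

countBelow-mono : ∀ {a b} → a ℕ.≤ b → ∀ s → countBelow a s ℕ.≤ countBelow b s
countBelow-mono a≤b []      = z≤n
countBelow-mono {a} {b} a≤b (x ∷ s) with x <? a | x <? b
... | yes x<a | yes x<b rewrite countBelow-∷-< s x<a | countBelow-∷-< s x<b
  = s≤s (countBelow-mono a≤b s)
... | yes x<a | no x≮b
  = ⊥-elim (x≮b (ℕ.<-≤-trans x<a a≤b))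
... | no x≮a  | yes x<b rewrite countBelow-∷-≮ s x≮a | countBelow-∷-< s x<b
  = ℕ.m≤n⇒m≤1+n (countBelow-mono a≤b s)
... | no x≮a  | no x≮b  rewrite countBelow-∷-≮ s x≮a | countBelow-∷-≮ s x≮b
  = countBelow-mono a≤b s

countBelow-strict : ∀ {a b} → a < b → ∀ {s} → a ∈ s → countBelow a s < countBelow b s
countBelow-strict {a} {b} a<b {x ∷ s} (here refl)
  rewrite countBelow-∷-≮ {a} {a} s (ℕ.<-irrefl refl) | countBelow-∷-< {b} {a} s a<b
  = s≤s (countBelow-mono (ℕ.<⇒≤ a<b) s)
countBelow-strict {a} {b} a<b {x ∷ s} (there a∈s) with x <? a | x <? b
... | yes x<a | yes x<b rewrite countBelow-∷-< s x<a | countBelow-∷-< s x<b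
  = s≤s (countBelow-strict a<b a∈s)
... | yes x<a | no x≮b
  = ⊥-elim (x≮b (ℕ.<-trans x<a a<b))
... | no x≮a  | yes x<b rewrite countBelow-∷-≮ s x≮a | countBelow-∷-< s x<b
  = ℕ.m≤n⇒m≤1+n (countBelow-strict a<b a∈s)
... | no x≮a  | no x≮b  rewrite countBelow-∷-≮ s x≮a | countBelow-∷-≮ s x≮b
  = countBelow-strict a<b a∈s

rank-strict : ∀ {s x z} → x ∈ s → x < z → rank s x < rank s z
rank-strict x∈s x<z = s≤s (countBelow-strict x<z x∈s)

rank-reflects-< : ∀ s {x z} → rank s x < rank s z → x < z
rank-reflects-< s rx<rz = ℕ.≰⇒> (λ z≤x → ℕ.<⇒≱ rx<rz (s≤s (countBelow-mono z≤x s)))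

rank-injective : ∀ {s x z} → x ∈ s → z ∈ s → rank s x ≡ rank s z → x ≡ z
rank-injective {x = x} {z} x∈s z∈s rx≡rz with ℕ.<-cmp x z
... | tri< x<z _ _ = ⊥-elim (ℕ.<⇒≢ (rank-strict x∈s x<z) rx≡rz)
... | tri≈ _ x≡z _ = x≡z
... | tri> _ _ z<x = ⊥-elim (ℕ.<⇒≢ (rank-strict z∈s z<x) (sym rx≡rz))

rank≤length : ∀ {s x} → x ∈ s → rank s x ℕ.≤ length s
rank≤length {s} {x} x∈s = List.filter-notAll (_<? x) s (Any.map (λ { refl → ℕ.<-irrefl refl }) x∈s)

rank-pivot : ∀ L y R → All (y <_) L → All (_< y) R → rank (L ++ y ∷ R) y ≡ suc (length R)
rank-pivot L y R y<L R<y = cong suc (begin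
  countBelow y (L ++ y ∷ R)               ≡⟨ countBelow-++ y L (y ∷ R) ⟩
  countBelow y L ℕ.+ countBelow y (y ∷ R) ≡⟨ cong₂ ℕ._+_ none-in-L (countBelow-∷-≮ R (ℕ.<-irrefl refl)) ⟩
  countBelow y R                          ≡⟨ cong length (List.filter-all (_<? y) R<y) ⟩
  length R                                ∎)
  where
  open ≡-Reasoning
  none-in-L : countBelow y L ≡ 0
  none-in-L = cong length (List.filter-none (_<? y) (All.map ℕ.<⇒≯ y<L))

𝟙-isSSFSplit?-rank : ∀ L y R → let s = L ++ y ∷ R in
  𝟙 (isSSFSplit? (mapSplit (rank s) (L ⟨ y ⟩ R))) ≡ 𝟙 (isSSFSplit? (L ⟨ y ⟩ R))
𝟙-isSSFSplit?-rank L y R = 𝟙-⇔ (isSSFSplit? _) (isSSFSplit? _) reflects preserves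
  where
  s = L ++ y ∷ R
  y∈s : y ∈ s
  y∈s = Membership.∈-++⁺ʳ L (here refl)
  reflects : IsSSFSplit (mapSplit (rank s) (L ⟨ y ⟩ R)) → IsSSFSplit (L ⟨ y ⟩ R)
  reflects (y<L , R<y) = All.map (rank-reflects-< s) (AllP.map⁻ y<L) , All.map (rank-reflects-< s) (AllP.map⁻ R<y)
  preserves : IsSSFSplit (L ⟨ y ⟩ R) → IsSSFSplit (mapSplit (rank s) (L ⟨ y ⟩ R))
  preserves (y<L , R<y) =
    AllP.map⁺ (All.map (rank-strict y∈s) y<L) ,
    AllP.map⁺ (All.tabulate (λ z∈R → rank-strict (Membership.∈-++⁺ʳ L (there z∈R)) (All.lookup R<y z∈R)))

ssfWeight-st : ∀ w s → ssfWeight w (st s) ≡ ssfWeight w s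
ssfWeight-st w s = begin
  ssfWeight w (map (rank s) s)                                      ≡⟨ cong (λ Ts → ∑ Ts term) (splits-map (rank s) s) ⟩
  ∑ (map (mapSplit (rank s)) (splits s)) term                        ≡⟨ ∑-map (mapSplit (rank s)) (splits s) term ⟩
  ∑[ T ∈ splits s ] term (mapSplit (rank s) T)                       ≡⟨ ∑-splits-cong s at-split ⟩
  ssfWeight w s                                                      ∎
  where
  open ≡-Reasoning
  term : Split → ℤ
  term T = 𝟙 (isSSFSplit? T) * w (length (left T)) (length (right T))
  at-split : ∀ L y R → L ++ y ∷ R ≡ s → term (mapSplit (rank s) (L ⟨ y ⟩ R)) ≡ term (L ⟨ y ⟩ R)
  at-split L y R refl =
    cong₂ _*_ (𝟙-isSSFSplit?-rank L y R)
          (cong₂ w (List.length-map (rank s) L) (List.length-map (rank s) R))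

Unique-map-injectiveOn : ∀ {f : ℕ → ℕ} {l} → (∀ {x z} → x ∈ l → z ∈ l → f x ≡ f z → x ≡ z) →
              Unique l → Unique (map f l)
Unique-map-injectiveOn inj-on-l []          = []
Unique-map-injectiveOn inj-on-l (x∉l ∷ l!) =
  AllP.map⁺ (All.tabulate (λ z∈l fx≡fz → All.lookup x∉l z∈l (inj-on-l (here refl) (there z∈l) fx≡fz)))
  ∷ Unique-map-injectiveOn (λ x∈l z∈l → inj-on-l (there x∈l) (there z∈l)) l!

st-isPerm : ∀ s → Unique s → IsPerm (st s)
st-isPerm s s! = Unique-map-injectiveOn rank-injective s! , AllP.map⁺ (All.tabulate bounds)
  where
  bounds : ∀ {x} → x ∈ s → 1 ℕ.≤ rank s x × rank s x ℕ.≤ length (st s)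
  bounds {x} x∈s = s≤s z≤n , subst (rank s x ℕ.≤_) (sym (List.length-map (rank s) s)) (rank≤length x∈s)

-- Pattern occurrences as sums over subsequences

words-length : ∀ m vs → All (λ w → length w ≡ m) (words m vs)
words-length zero    vs = refl ∷ []
words-length (suc m) vs =
  AllP.concat⁺ (AllP.map⁺ {xs = vs} {f = λ v → map (v ∷_) (words m vs)}
    (All.tabulate (λ _ → AllP.map⁺ (All.map (cong suc) (words-length m vs)))))

perms-length : ∀ m → All (λ π → length π ≡ m) (perms m)
perms-length m = AllP.filter⁺ isPerm? (words-length m (range1 m))

∈-range1 : ∀ {m x} → 1 ℕ.≤ x → x ℕ.≤ m → x ∈ range1 m
∈-range1 {x = suc x} (s≤s _) x≤m = Membership.∈-map⁺ suc (Membership.∈-upTo⁺ x≤m)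

range1-unique : ∀ m → Unique (range1 m)
range1-unique m = UniqueP.map⁺ ℕ.suc-injective (UniqueP.upTo⁺ m)

𝟙-≡-∷ : ∀ a as b bs →
        𝟙 (≡-dec ℕ._≟_ (a ∷ as) (b ∷ bs)) ≡ 𝟙 (a ℕ.≟ b) * 𝟙 (≡-dec ℕ._≟_ as bs)
𝟙-≡-∷ a as b bs =
  trans (𝟙-⇔ (≡-dec ℕ._≟_ (a ∷ as) (b ∷ bs)) ((a ℕ.≟ b) ×-dec ≡-dec ℕ._≟_ as bs)
             List.∷-injective (λ { (refl , refl) → refl }))
        (𝟙-× (a ℕ.≟ b) (≡-dec ℕ._≟_ as bs))

∑-𝟙≟-unique : ∀ {w vs} → Unique vs → w ∈ vs → ∑[ v ∈ vs ] 𝟙 (w ℕ.≟ v) ≡ + 1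
∑-𝟙≟-unique {w} {_ ∷ vs} (w∉vs ∷ _) (here refl) =
  cong₂ _+_ (𝟙-yes (w ℕ.≟ w) refl)
            (trans (∑-cong-All (All.map (𝟙-no (w ℕ.≟ _)) w∉vs)) (∑-zero vs (λ _ → refl)))
∑-𝟙≟-unique {w} {v ∷ vs} (v∉vs ∷ vs!) (there w∈vs) =
  trans (cong₂ _+_ (𝟙-no (w ℕ.≟ v) (λ w≡v → All.lookup v∉vs w∈vs (sym w≡v))) (∑-𝟙≟-unique vs! w∈vs))
        (ℤ.+-identityˡ (+ 1))

∑-words-𝟙≡ : ∀ {vs} → Unique vs → ∀ w → All (_∈ vs) w →
             ∑[ u ∈ words (length w) vs ] 𝟙 (≡-dec ℕ._≟_ w u) ≡ + 1
∑-words-𝟙≡ vs! []       []              = refl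
∑-words-𝟙≡ {vs} vs! (a ∷ w) (a∈vs ∷ w⊆vs) = begin
  ∑ (concatMap (λ v → map (v ∷_) (words n vs)) vs) (λ u → 𝟙 (≡-dec ℕ._≟_ (a ∷ w) u))
    ≡⟨ ∑-concatMap (λ v → map (v ∷_) (words n vs)) vs _ ⟩
  ∑[ v ∈ vs ] ∑ (map (v ∷_) (words n vs)) (λ u → 𝟙 (≡-dec ℕ._≟_ (a ∷ w) u))
    ≡⟨ ∑-cong vs first-letter ⟩
  ∑[ v ∈ vs ] 𝟙 (a ℕ.≟ v)
    ≡⟨ ∑-𝟙≟-unique vs! a∈vs ⟩
  + 1 ∎
  where
  open ≡-Reasoning
  n = length w
  first-letter : ∀ v → ∑ (map (v ∷_) (words n vs)) (λ u → 𝟙 (≡-dec ℕ._≟_ (a ∷ w) u)) ≡ 𝟙 (a ℕ.≟ v)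
  first-letter v = begin
    ∑ (map (v ∷_) (words n vs)) (λ u → 𝟙 (≡-dec ℕ._≟_ (a ∷ w) u))
      ≡⟨ ∑-map (v ∷_) (words n vs) _ ⟩
    ∑[ u ∈ words n vs ] 𝟙 (≡-dec ℕ._≟_ (a ∷ w) (v ∷ u))
      ≡⟨ ∑-cong (words n vs) (𝟙-≡-∷ a w v) ⟩
    ∑[ u ∈ words n vs ] (𝟙 (a ℕ.≟ v) * 𝟙 (≡-dec ℕ._≟_ w u))
      ≡⟨ ∑-*ˡ (𝟙 (a ℕ.≟ v)) (words n vs) _ ⟩
    𝟙 (a ℕ.≟ v) * ∑[ u ∈ words n vs ] 𝟙 (≡-dec ℕ._≟_ w u)
      ≡⟨ cong (𝟙 (a ℕ.≟ v) *_) (∑-words-𝟙≡ vs! w w⊆vs) ⟩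
    𝟙 (a ℕ.≟ v) * + 1
      ≡⟨ ℤ.*-identityʳ _ ⟩
    𝟙 (a ℕ.≟ v) ∎

∑-perms-𝟙≡ : ∀ w → IsPerm w → ∑[ π ∈ perms (length w) ] 𝟙 (≡-dec ℕ._≟_ w π) ≡ + 1
∑-perms-𝟙≡ w w-perm@(_ , w-bounded) = begin
  ∑ (filter isPerm? (words n (range1 n))) (λ π → 𝟙 (≡-dec ℕ._≟_ w π))
    ≡⟨ ∑-filter isPerm? (words n (range1 n)) _ ⟩
  ∑[ u ∈ words n (range1 n) ] (𝟙 (isPerm? u) * 𝟙 (≡-dec ℕ._≟_ w u))
    ≡⟨ ∑-cong (words n (range1 n)) only-w-counts ⟩
  ∑[ u ∈ words n (range1 n) ] 𝟙 (≡-dec ℕ._≟_ w u)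
    ≡⟨ ∑-words-𝟙≡ (range1-unique n) w (All.map (λ (1≤x , x≤n) → ∈-range1 1≤x x≤n) w-bounded) ⟩
  + 1 ∎
  where
  open ≡-Reasoning
  n = length w
  only-w-counts : ∀ u → 𝟙 (isPerm? u) * 𝟙 (≡-dec ℕ._≟_ w u) ≡ 𝟙 (≡-dec ℕ._≟_ w u)
  only-w-counts u with ≡-dec ℕ._≟_ w u
  ... | yes refl = cong (_* + 1) (𝟙-yes (isPerm? w) w-perm)
  ... | no _     = ℤ.*-zeroʳ (𝟙 (isPerm? u))

∑-perms-sift : ∀ (f : List ℕ → ℤ) w → IsPerm w →
               ∑[ π ∈ perms (length w) ] (f π * 𝟙 (≡-dec ℕ._≟_ w π)) ≡ f w
∑-perms-sift f w w-perm = begin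
  ∑[ π ∈ perms (length w) ] (f π * 𝟙 (≡-dec ℕ._≟_ w π))  ≡⟨ ∑-cong (perms (length w)) replace-by-w ⟩
  ∑[ π ∈ perms (length w) ] (f w * 𝟙 (≡-dec ℕ._≟_ w π))  ≡⟨ ∑-*ˡ (f w) (perms (length w)) _ ⟩
  f w * ∑[ π ∈ perms (length w) ] 𝟙 (≡-dec ℕ._≟_ w π)    ≡⟨ cong (f w *_) (∑-perms-𝟙≡ w w-perm) ⟩
  f w * + 1                                               ≡⟨ ℤ.*-identityʳ (f w) ⟩
  f w                                                     ∎
  where
  open ≡-Reasoning
  replace-by-w : ∀ π → f π * 𝟙 (≡-dec ℕ._≟_ w π) ≡ f w * 𝟙 (≡-dec ℕ._≟_ w π)
  replace-by-w π with ≡-dec ℕ._≟_ w π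
  ... | yes refl = refl
  ... | no _     = trans (ℤ.*-zeroʳ (f π)) (sym (ℤ.*-zeroʳ (f w)))

subseqs-length : ∀ m τ → All (λ s → length s ≡ m) (subseqs m τ)
subseqs-length zero    τ        = refl ∷ []
subseqs-length (suc m) []       = []
subseqs-length (suc m) (x ∷ xs) =
  AllP.++⁺ (AllP.map⁺ (All.map (cong suc) (subseqs-length m xs))) (subseqs-length (suc m) xs)

subseqs-unique : ∀ m τ → Unique τ → All (λ s → Unique s × All (_∈ τ) s) (subseqs m τ)
subseqs-unique zero    τ        τ!           = ([] , []) ∷ []
subseqs-unique (suc m) []       τ!           = []
subseqs-unique (suc m) (x ∷ xs) (x∉xs ∷ xs!) =
  AllP.++⁺ (AllP.map⁺ (All.map with-x (subseqs-unique m xs xs!)))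
           (All.map without-x (subseqs-unique (suc m) xs xs!))
  where
  with-x : ∀ {s} → Unique s × All (_∈ xs) s → Unique (x ∷ s) × All (_∈ x ∷ xs) (x ∷ s)
  with-x (s! , s⊆xs) = (All.map (All.lookup x∉xs) s⊆xs ∷ s!) , here refl ∷ All.map there s⊆xs
  without-x : ∀ {s} → Unique s × All (_∈ xs) s → Unique s × All (_∈ x ∷ xs) s
  without-x (s! , s⊆xs) = s! , All.map there s⊆xs

occ≡∑ : ∀ {m} π τ → length π ≡ m → + occ π τ ≡ ∑[ s ∈ subseqs m τ ] 𝟙 (≡-dec ℕ._≟_ (st s) π)
occ≡∑ π τ refl = length-filter≡∑𝟙 (λ s → ≡-dec ℕ._≟_ (st s) π) (subseqs (length π) τ)

∑-perms-occ : ∀ (f : List ℕ → ℤ) m τ → Unique τ →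
              ∑[ π ∈ perms m ] (f π * + occ π τ) ≡ ∑[ s ∈ subseqs m τ ] f (st s)
∑-perms-occ f m τ τ! = begin
  ∑[ π ∈ perms m ] (f π * + occ π τ)
    ≡⟨ ∑-cong-All (All.map (λ {π} |π|≡m → cong (f π *_) (occ≡∑ π τ |π|≡m)) (perms-length m)) ⟩
  ∑[ π ∈ perms m ] (f π * ∑[ s ∈ subseqs m τ ] 𝟙 (≡-dec ℕ._≟_ (st s) π))
    ≡⟨ ∑-cong (perms m) (λ π → sym (∑-*ˡ (f π) (subseqs m τ) _)) ⟩
  ∑[ π ∈ perms m ] ∑[ s ∈ subseqs m τ ] (f π * 𝟙 (≡-dec ℕ._≟_ (st s) π))
    ≡⟨ ∑-comm (perms m) (subseqs m τ) _ ⟩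
  ∑[ s ∈ subseqs m τ ] ∑[ π ∈ perms m ] (f π * 𝟙 (≡-dec ℕ._≟_ (st s) π))
    ≡⟨ ∑-cong-All (All.zipWith (λ (|s|≡m , s! , _) → sift s! |s|≡m)
                               (subseqs-length m τ , subseqs-unique m τ τ!)) ⟩
  ∑[ s ∈ subseqs m τ ] f (st s) ∎
  where
  open ≡-Reasoning
  sift : ∀ {s n} → Unique s → length s ≡ n → ∑[ π ∈ perms n ] (f π * 𝟙 (≡-dec ℕ._≟_ (st s) π)) ≡ f (st s)
  sift {s} s! refl = subst (λ n → ∑[ π ∈ perms n ] (f π * 𝟙 (≡-dec ℕ._≟_ (st s) π)) ≡ f (st s))
                           (List.length-map (rank s) s) (∑-perms-sift f (st s) (st-isPerm s s!))

∑-upTo-suc : ∀ n (g : ℕ → ℤ) → ∑ (upTo (suc n)) g ≡ g 0 + ∑[ m ∈ upTo n ] g (suc m)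
∑-upTo-suc n g =
  cong (_+_ (g 0)) (trans (cong (λ ms → ∑ ms g) (sym (List.map-upTo suc n))) (∑-map suc (upTo n) g))

∑-subseqs≡∑-sublists : ∀ τ N (F : List ℕ → ℤ) → length τ ℕ.≤ N →
                        ∑[ m ∈ upTo (suc N) ] ∑ (subseqs m τ) F ≡ ∑ (sublists τ) F
∑-subseqs≡∑-sublists [] N F _ = begin
  ∑[ m ∈ upTo (suc N) ] ∑ (subseqs m []) F
    ≡⟨ ∑-upTo-suc N (λ m → ∑ (subseqs m []) F) ⟩
  (F [] + + 0) + ∑[ m ∈ upTo N ] ∑ (subseqs (suc m) []) F
    ≡⟨ cong (_+_ (F [] + + 0)) (∑-zero (upTo N) (λ _ → refl)) ⟩
  (F [] + + 0) + + 0
    ≡⟨ ℤ.+-identityʳ (F [] + + 0) ⟩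
  F [] + + 0 ∎
  where open ≡-Reasoning
∑-subseqs≡∑-sublists (t ∷ τ) (suc N) F (s≤s |τ|≤N) = begin
  ∑[ m ∈ upTo (suc (suc N)) ] ∑ (subseqs m (t ∷ τ)) F
    ≡⟨ ∑-upTo-suc (suc N) (λ m → ∑ (subseqs m (t ∷ τ)) F) ⟩
  F [] + + 0 + ∑[ m ∈ upTo (suc N) ] ∑ (map (t ∷_) (subseqs m τ) ++ subseqs (suc m) τ) F
    ≡⟨ cong (_+_ (F [] + + 0))
            (trans (∑-cong (upTo (suc N)) split-by-t) (∑-+ (upTo (suc N)) with-t without-t)) ⟩
  F [] + + 0 + (∑ (upTo (suc N)) with-t + ∑ (upTo (suc N)) without-t)
    ≡⟨ rearrange (F [] + + 0) (∑ (upTo (suc N)) with-t) (∑ (upTo (suc N)) without-t) ⟩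
  ∑ (upTo (suc N)) with-t + (F [] + + 0 + ∑ (upTo (suc N)) without-t)
    ≡⟨ cong₂ _+_ (∑-subseqs≡∑-sublists τ N (λ s → F (t ∷ s)) |τ|≤N)
                 (trans (sym (∑-upTo-suc (suc N) (λ m → ∑ (subseqs m τ) F)))
                        (∑-subseqs≡∑-sublists τ (suc N) F (ℕ.m≤n⇒m≤1+n |τ|≤N))) ⟩
  ∑[ s ∈ sublists τ ] F (t ∷ s) + ∑ (sublists τ) F
    ≡⟨ ∑-sublists-∷ t τ F ⟨
  ∑ (sublists (t ∷ τ)) F ∎
  where
  open ≡-Reasoning
  with-t without-t : ℕ → ℤ
  with-t    m = ∑[ s ∈ subseqs m τ ] F (t ∷ s)
  without-t m = ∑ (subseqs (suc m) τ) F
  split-by-t : ∀ m → ∑ (map (t ∷_) (subseqs m τ) ++ subseqs (suc m) τ) F ≡ with-t m + without-t m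
  split-by-t m = trans (∑-++ (map (t ∷_) (subseqs m τ)) _ F) (cong (_+ without-t m) (∑-map (t ∷_) (subseqs m τ) F))
  rearrange : ∀ a b c → a + (b + c) ≡ b + (a + c)
  rearrange = solve-∀

sumPermsUpTo-occ : ∀ (f : List ℕ → ℤ) τ N → Unique τ → length τ ℕ.≤ N →
                   sumPermsUpTo N (λ π → f π * + occ π τ) ≡ ∑[ s ∈ sublists τ ] f (st s)
sumPermsUpTo-occ f τ N τ! |τ|≤N = begin
  sumPermsUpTo N (λ π → f π * + occ π τ)
    ≡⟨ sumℤ-map (λ m → sumℤ (map (λ π → f π * + occ π τ) (perms m))) (upTo (suc N)) ⟩
  ∑[ m ∈ upTo (suc N) ] sumℤ (map (λ π → f π * + occ π τ) (perms m))
    ≡⟨ ∑-cong (upTo (suc N)) (λ m → trans (sumℤ-map (λ π → f π * + occ π τ) (perms m))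
                                          (∑-perms-occ f m τ τ!)) ⟩
  ∑[ m ∈ upTo (suc N) ] ∑[ s ∈ subseqs m τ ] f (st s)
    ≡⟨ ∑-subseqs≡∑-sublists τ N (λ s → f (st s)) |τ|≤N ⟩
  ∑[ s ∈ sublists τ ] f (st s) ∎
  where open ≡-Reasoning

-- Values of a permutation

length≤1+length-filter-< : ∀ {n xs} → Unique xs → All (_< suc n) xs →
                           length xs ℕ.≤ suc (length (filter (_<? n) xs))
length≤1+length-filter-< {n} {[]}     _            _                 = z≤n
length≤1+length-filter-< {n} {x ∷ xs} (x∉xs ∷ xs!) (x<1+n ∷ xs<1+n) with x <? n
... | yes x<n rewrite List.filter-accept (_<? n) {xs = xs} x<n =
  s≤s (length≤1+length-filter-< xs! xs<1+n)
... | no x≮n = ℕ.≤-reflexive (cong suc (sym (begin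
  length (filter (_<? n) (x ∷ xs))  ≡⟨ cong length (List.filter-reject (_<? n) x≮n) ⟩
  length (filter (_<? n) xs)        ≡⟨ cong length (List.filter-all (_<? n) xs<n) ⟩
  length xs                         ∎)))
  where
  open ≡-Reasoning
  x≡n : x ≡ n
  x≡n = ℕ.≤∧≮⇒≡ (ℕ.s≤s⁻¹ x<1+n) x≮n
  xs<n : All (_< n) xs
  xs<n = All.zipWith (λ (x≢z , z<1+n) → ℕ.≤∧≢⇒< (ℕ.s≤s⁻¹ z<1+n) (λ z≡n → x≢z (trans x≡n (sym z≡n))))
                     (x∉xs , xs<1+n)

length-unique-between : ∀ {a} b {xs} → Unique xs → All (λ x → a ℕ.≤ x × x < b) xs →
                        length xs ℕ.≤ b ∸ a
length-unique-between b       {[]}     _   _                     = z≤n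
length-unique-between zero    {x ∷ xs} _   ((_ , ()) ∷ _)
length-unique-between {a} (suc b) {xs@(_ ∷ _)} xs! bounds@((a≤x , x<1+b) ∷ _) = begin
  length xs                          ≤⟨ length≤1+length-filter-< xs! (All.map proj₂ bounds) ⟩
  suc (length (filter (_<? b) xs))   ≤⟨ s≤s (length-unique-between b (UniqueP.filter⁺ (_<? b) xs!) filtered-bounds) ⟩
  suc (b ∸ a)                        ≡⟨ ℕ.+-∸-assoc 1 (ℕ.≤-trans a≤x (ℕ.s≤s⁻¹ x<1+b)) ⟨
  suc b ∸ a                          ∎
  where
  open ℕ.≤-Reasoning
  filtered-bounds : All (λ x → a ℕ.≤ x × x < b) (filter (_<? b) xs)
  filtered-bounds = All.zipWith (λ ((a≤z , _) , z<b) → a≤z , z<b)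
                                (AllP.filter⁺ (_<? b) bounds , AllP.all-filter (_<? b) xs)

length-filter+length-filter-∁ : ∀ {P : ℕ → Set} (P? : ∀ x → Dec (P x)) xs →
  length (filter P? xs) ℕ.+ length (filter (∁? P?) xs) ≡ length xs
length-filter+length-filter-∁ P? []       = refl
length-filter+length-filter-∁ P? (x ∷ xs) with ih ← length-filter+length-filter-∁ P? xs | does (P? x)
... | true  = cong suc ih
... | false = trans (ℕ.+-suc _ _) (cong suc ih)

-- Pigeonhole: of the n distinct values in [1, n], c lie below y and g do not, so c = y - 1.
squeeze : ∀ {c g n y} → c ℕ.≤ y ∸ 1 → g ℕ.≤ suc n ∸ y → c ℕ.+ g ≡ n →
          1 ℕ.≤ y → y ℕ.≤ suc n → suc c ≡ y
squeeze {c} {g} {n} {suc y} c≤y g≤ c+g≡n _ y≤1+n =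
  ℕ.≤-antisym (s≤s c≤y) (ℕ.+-cancelʳ-≤ (suc n ∸ suc y) (suc y) (suc c) (begin
    suc y ℕ.+ (suc n ∸ suc y)  ≡⟨ ℕ.m+[n∸m]≡n y≤1+n ⟩
    suc n                      ≡⟨ cong suc c+g≡n ⟨
    suc c ℕ.+ g                ≤⟨ ℕ.+-monoʳ-≤ (suc c) g≤ ⟩
    suc c ℕ.+ (suc n ∸ suc y)  ∎))
  where open ℕ.≤-Reasoning

rank-perm : ∀ {τ y} → IsPerm τ → y ∈ τ → rank τ y ≡ y
rank-perm {τ} {y} (τ! , τ-bounded) y∈τ =
  squeeze below-bound atLeast-bound (length-filter+length-filter-∁ (_<? y) τ) 1≤y y≤1+n
  where
  1≤y = proj₁ (All.lookup τ-bounded y∈τ)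
  y≤1+n = ℕ.m≤n⇒m≤1+n (proj₂ (All.lookup τ-bounded y∈τ))
  below-bound : length (filter (_<? y) τ) ℕ.≤ y ∸ 1
  below-bound = length-unique-between y (UniqueP.filter⁺ (_<? y) τ!)
    (All.zipWith (λ ((1≤x , _) , x<y) → 1≤x , x<y) (AllP.filter⁺ (_<? y) τ-bounded , AllP.all-filter (_<? y) τ))
  atLeast-bound : length (filter (∁? (_<? y)) τ) ℕ.≤ suc (length τ) ∸ y
  atLeast-bound = length-unique-between (suc (length τ)) (UniqueP.filter⁺ (∁? (_<? y)) τ!)
    (All.zipWith (λ ((_ , x≤n) , x≮y) → ℕ.≮⇒≥ x≮y , s≤s x≤n)
                 (AllP.filter⁺ (∁? (_<? y)) τ-bounded , AllP.all-filter (∁? (_<? y)) τ))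

Unique-++-∷⇒∉ : ∀ L (y : ℕ) R → Unique (L ++ y ∷ R) → All (_≢ y) L
Unique-++-∷⇒∉ []      y R _            = []
Unique-++-∷⇒∉ (x ∷ L) y R (x∉rest ∷ rest!) =
  All.lookup x∉rest (Membership.∈-++⁺ʳ L (here refl)) ∷ Unique-++-∷⇒∉ L y R rest!

ssf-pivot-value : ∀ L y R → IsPerm (L ++ y ∷ R) → IsSSFSplit (L ⟨ y ⟩ R) → y ≡ suc (length R)
ssf-pivot-value L y R τ-perm (y<L , R<y) =
  trans (sym (rank-perm τ-perm (Membership.∈-++⁺ʳ L (here refl)))) (rank-pivot L y R y<L R<y)

countAbove : ℕ → List ℕ → ℕ
countAbove a s = length (filter (a <?_) s)

length≡countBelow+countAbove : ∀ y l → All (_≢ y) l → length l ≡ countBelow y l ℕ.+ countAbove y l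
length≡countBelow+countAbove y []      []           = refl
length≡countBelow+countAbove y (x ∷ l) (x≢y ∷ l≢y) with ℕ.<-cmp x y
... | tri< x<y _ y≮x rewrite countBelow-∷-< l x<y | List.filter-reject (y <?_) {xs = l} y≮x =
  cong suc (length≡countBelow+countAbove y l l≢y)
... | tri≈ _ x≡y _ = ⊥-elim (x≢y x≡y)
... | tri> x≮y _ y<x rewrite countBelow-∷-≮ l x≮y | List.filter-accept (y <?_) {xs = l} y<x =
  trans (cong suc (length≡countBelow+countAbove y l l≢y)) (sym (ℕ.+-suc _ _))

pivot-excess : ∀ L y R → IsPerm (L ++ y ∷ R) →
               + y - + suc (length L) ≡ + countBelow y R - + countAbove y L
pivot-excess L y R τ-perm@(τ! , _) = begin
  + y - + suc (length L)
    ≡⟨ cong₂ (λ v l → + v - + suc l) (sym (rank-perm τ-perm (Membership.∈-++⁺ʳ L (here refl))))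
                                      (length≡countBelow+countAbove y L (Unique-++-∷⇒∉ L y R τ!)) ⟩
  + rank (L ++ y ∷ R) y - + suc (countBelow y L ℕ.+ countAbove y L)
    ≡⟨ cong (λ c → + suc c - + suc (countBelow y L ℕ.+ countAbove y L)) below-y ⟩
  + suc (countBelow y L ℕ.+ countBelow y R) - + suc (countBelow y L ℕ.+ countAbove y L)
    ≡⟨ cancel-common (countBelow y L) (countBelow y R) (countAbove y L) ⟩
  + countBelow y R - + countAbove y L ∎
  where
  open ≡-Reasoning
  below-y : countBelow y (L ++ y ∷ R) ≡ countBelow y L ℕ.+ countBelow y R
  below-y = trans (countBelow-++ y L (y ∷ R)) (cong (countBelow y L ℕ.+_) (countBelow-∷-≮ R (ℕ.<-irrefl refl)))
  cancel-common : ∀ b r a → + suc (b ℕ.+ r) - + suc (b ℕ.+ a) ≡ + r - + a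
  cancel-common b r a = begin
    + suc (b ℕ.+ r) - + suc (b ℕ.+ a)        ≡⟨ cong₂ (λ x z → + 1 + x - (+ 1 + z)) (ℤ.pos-+ b r) (ℤ.pos-+ b a) ⟩
    + 1 + (+ b + + r) - (+ 1 + (+ b + + a))  ≡⟨ ring (+ b) (+ r) (+ a) ⟩
    + r - + a                                ∎
    where
    ring : ∀ b r a → + 1 + (b + r) - (+ 1 + (b + a)) ≡ r - a
    ring = solve-∀

ssfSum≡ssfWeight : ∀ (c : ℕ → ℤ) (b : ℕ → ℕ → ℤ) π → IsPerm π →
  c (length π) * sumℤ (map (b (length π)) (SSF π)) ≡
  ssfWeight (λ i l → c (i ℕ.+ suc l) * b (i ℕ.+ suc l) (suc l)) π
ssfSum≡ssfWeight c b π π-perm = begin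
  c n * sumℤ (map (b n) (SSF π))                                 ≡⟨ cong (c n *_) (sumℤ-SSF π (b n)) ⟩
  c n * ∑[ T ∈ splits π ] (𝟙 (isSSFSplit? T) * b n (pivot T))    ≡⟨ ∑-*ˡ (c n) (splits π) _ ⟨
  ∑[ T ∈ splits π ] (c n * (𝟙 (isSSFSplit? T) * b n (pivot T)))  ≡⟨ ∑-splits-cong π at-split ⟩
  ssfWeight w π                                                  ∎
  where
  open ≡-Reasoning
  n = length π
  w : ℕ → ℕ → ℤ
  w i l = c (i ℕ.+ suc l) * b (i ℕ.+ suc l) (suc l)
  at-split : ∀ L y R → L ++ y ∷ R ≡ π →
    c n * (𝟙 (isSSFSplit? (L ⟨ y ⟩ R)) * b n y) ≡ 𝟙 (isSSFSplit? (L ⟨ y ⟩ R)) * w (length L) (length R)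
  at-split L y R refl with isSSFSplit? (L ⟨ y ⟩ R)
  ... | yes ssf = begin
    c n * (+ 1 * b n y)              ≡⟨ cong (c n *_) (ℤ.*-identityˡ (b n y)) ⟩
    c n * b n y                      ≡⟨ cong₂ (λ m v → c m * b m v) (List.length-++ L) (ssf-pivot-value L y R π-perm ssf) ⟩
    c m * b m (suc (length R))       ≡⟨ ℤ.*-identityˡ _ ⟨
    + 1 * (c m * b m (suc (length R))) ∎
    where m = length L ℕ.+ suc (length R)
  ... | no _    = ℤ.*-zeroʳ (c n)

-- Double counting pairs (subsequence, skew strong fixed point)

pairSum : (ℕ → ℕ → ℤ) → List ℕ → List ℕ → ℤ
pairSum H A B = ∑[ s ∈ sublists A ] ∑[ t ∈ sublists B ] H (length s) (length t)

shiftˡ : (ℕ → ℕ → ℤ) → ℕ → ℕ → ℤ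
shiftˡ H i l = H (suc i) l

pairSum-∷ˡ : ∀ H x A B → pairSum H (x ∷ A) B ≡ pairSum (shiftˡ H) A B + pairSum H A B
pairSum-∷ˡ H x A B = ∑-sublists-∷ x A (λ s → ∑[ t ∈ sublists B ] H (length s) (length t))

larger smaller : Split → List ℕ
larger  T = filter (pivot T <?_) (left T)
smaller T = filter (_<? pivot T) (right T)

-- U records letters already placed left of the word (all must exceed the pivot); H is pre-shifted by their number.
ssfTerm pairTerm : (ℕ → ℕ → ℤ) → List ℕ → Split → ℤ
ssfTerm  H U T = 𝟙 (All.all? (pivot T <?_) U ×-dec isSSFSplit? T) * H (length (left T)) (length (right T))
pairTerm H U T = 𝟙 (All.all? (pivot T <?_) U) * pairSum H (larger T) (smaller T)

ssfTerm-head : ∀ H U t s →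
  ssfTerm H U ([] ⟨ t ⟩ s) ≡ 𝟙 (All.all? (t <?_) U) * (𝟙 (All.all? (_<? t) s) * H 0 (length s))
ssfTerm-head H U t s = begin
  𝟙 (U>t ×-dec isSSFSplit? ([] ⟨ t ⟩ s)) * H 0 (length s)
    ≡⟨ cong (_* H 0 (length s)) (𝟙-⇔ (U>t ×-dec isSSFSplit? ([] ⟨ t ⟩ s)) (U>t ×-dec s<t) forget-[] add-[]) ⟩
  𝟙 (U>t ×-dec s<t) * H 0 (length s)
    ≡⟨ cong (_* H 0 (length s)) (𝟙-× U>t s<t) ⟩
  𝟙 U>t * 𝟙 s<t * H 0 (length s)
    ≡⟨ ℤ.*-assoc (𝟙 U>t) (𝟙 s<t) (H 0 (length s)) ⟩
  𝟙 U>t * (𝟙 s<t * H 0 (length s)) ∎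
  where
  open ≡-Reasoning
  U>t = All.all? (t <?_) U
  s<t = All.all? (_<? t) s
  forget-[] : All (t <_) U × IsSSFSplit ([] ⟨ t ⟩ s) → All (t <_) U × All (_< t) s
  forget-[] (u , _ , r) = u , r
  add-[] : All (t <_) U × All (_< t) s → All (t <_) U × IsSSFSplit ([] ⟨ t ⟩ s)
  add-[] (u , r) = u , [] , r

ssfTerm-consˡ : ∀ H U t T → ssfTerm H U (consˡ t T) ≡ ssfTerm (shiftˡ H) (t ∷ U) T
ssfTerm-consˡ H U t T@(L ⟨ y ⟩ R) = cong (_* H (suc (length L)) (length R))
  (𝟙-⇔ (All.all? (y <?_) U ×-dec isSSFSplit? (consˡ t T)) (All.all? (y <?_) (t ∷ U) ×-dec isSSFSplit? T)
       (λ { (u , (p ∷ l) , r) → (p ∷ u) , l , r }) (λ { ((p ∷ u) , l , r) → u , (p ∷ l) , r }))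

ssfCount pairCount : (ℕ → ℕ → ℤ) → List ℕ → List ℕ → ℤ
ssfCount  H U τ = ∑[ s ∈ sublists τ ] ∑ (splits s) (ssfTerm H U)
pairCount H U τ = ∑ (splits τ) (pairTerm H U)

firstPivotTerm : (ℕ → ℕ → ℤ) → List ℕ → ℕ → List ℕ → ℤ
firstPivotTerm H U t τ = 𝟙 (All.all? (t <?_) U) * ∑[ s ∈ sublists (filter (_<? t) τ) ] H 0 (length s)

ssfCount-∷ : ∀ H U t τ →
  ssfCount H U (t ∷ τ) ≡ firstPivotTerm H U t τ + (ssfCount (shiftˡ H) (t ∷ U) τ + ssfCount H U τ)
ssfCount-∷ H U t τ = begin
  ssfCount H U (t ∷ τ)
    ≡⟨ ∑-sublists-∷ t τ (λ s → ∑ (splits s) (ssfTerm H U)) ⟩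
  ∑[ s ∈ sublists τ ] ∑ (splits (t ∷ s)) (ssfTerm H U) + ssfCount H U τ
    ≡⟨ cong (_+ ssfCount H U τ) (trans (∑-cong (sublists τ) pivot-first-or-not)
                                       (∑-+ (sublists τ) head-term (λ s → ∑ (splits s) (ssfTerm (shiftˡ H) (t ∷ U))))) ⟩
  (∑ (sublists τ) head-term + ssfCount (shiftˡ H) (t ∷ U) τ) + ssfCount H U τ
    ≡⟨ cong (λ x → x + ssfCount (shiftˡ H) (t ∷ U) τ + ssfCount H U τ) head-terms ⟩
  (firstPivotTerm H U t τ + ssfCount (shiftˡ H) (t ∷ U) τ) + ssfCount H U τ
    ≡⟨ ℤ.+-assoc (firstPivotTerm H U t τ) (ssfCount (shiftˡ H) (t ∷ U) τ) (ssfCount H U τ) ⟩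
  firstPivotTerm H U t τ + (ssfCount (shiftˡ H) (t ∷ U) τ + ssfCount H U τ) ∎
  where
  open ≡-Reasoning
  head-term : List ℕ → ℤ
  head-term s = 𝟙 (All.all? (t <?_) U) * (𝟙 (All.all? (_<? t) s) * H 0 (length s))
  pivot-first-or-not : ∀ s →
    ∑ (splits (t ∷ s)) (ssfTerm H U) ≡ head-term s + ∑ (splits s) (ssfTerm (shiftˡ H) (t ∷ U))
  pivot-first-or-not s = trans (∑-splits-∷ t s (ssfTerm H U))
    (cong₂ _+_ (ssfTerm-head H U t s) (∑-cong (splits s) (ssfTerm-consˡ H U t)))
  head-terms : ∑ (sublists τ) head-term ≡ firstPivotTerm H U t τ
  head-terms = trans (∑-*ˡ (𝟙 (All.all? (t <?_) U)) (sublists τ) (λ s → 𝟙 (All.all? (_<? t) s) * H 0 (length s)))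
                     (cong (𝟙 (All.all? (t <?_) U) *_) (∑-sublists-All (_<? t) τ (λ s → H 0 (length s))))

pairTerm-consˡ : ∀ H U t T → pairTerm H U (consˡ t T) ≡ pairTerm (shiftˡ H) (t ∷ U) T + pairTerm H U T
pairTerm-consˡ H U t T@(L ⟨ y ⟩ R) = by-cases (y <? t)
  where
  open ≡-Reasoning
  U>y = All.all? (y <?_) U
  Aᵀ = larger T
  Bᵀ = smaller T
  by-cases : Dec (y < t) → pairTerm H U (consˡ t T) ≡ pairTerm (shiftˡ H) (t ∷ U) T + pairTerm H U T
  by-cases (yes y<t) = begin
    𝟙 U>y * pairSum H (filter (y <?_) (t ∷ L)) Bᵀ
      ≡⟨ cong (λ A → 𝟙 U>y * pairSum H A Bᵀ) (List.filter-accept (y <?_) y<t) ⟩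
    𝟙 U>y * pairSum H (t ∷ Aᵀ) Bᵀ
      ≡⟨ cong (𝟙 U>y *_) (pairSum-∷ˡ H t Aᵀ Bᵀ) ⟩
    𝟙 U>y * (pairSum (shiftˡ H) Aᵀ Bᵀ + pairSum H Aᵀ Bᵀ)
      ≡⟨ ℤ.*-distribˡ-+ (𝟙 U>y) (pairSum (shiftˡ H) Aᵀ Bᵀ) (pairSum H Aᵀ Bᵀ) ⟩
    𝟙 U>y * pairSum (shiftˡ H) Aᵀ Bᵀ + 𝟙 U>y * pairSum H Aᵀ Bᵀ
      ≡⟨ cong (λ i → i * pairSum (shiftˡ H) Aᵀ Bᵀ + 𝟙 U>y * pairSum H Aᵀ Bᵀ)
              (𝟙-⇔ U>y (All.all? (y <?_) (t ∷ U)) (y<t ∷_) All.tail) ⟩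
    pairTerm (shiftˡ H) (t ∷ U) T + pairTerm H U T ∎
  by-cases (no y≮t) = begin
    𝟙 U>y * pairSum H (filter (y <?_) (t ∷ L)) Bᵀ
      ≡⟨ cong (λ A → 𝟙 U>y * pairSum H A Bᵀ) (List.filter-reject (y <?_) y≮t) ⟩
    pairTerm H U T
      ≡⟨ ℤ.+-identityˡ (pairTerm H U T) ⟨
    + 0 + pairTerm H U T
      ≡⟨ cong (λ i → i * pairSum (shiftˡ H) Aᵀ Bᵀ + pairTerm H U T)
              (𝟙-no (All.all? (y <?_) (t ∷ U)) (λ { (y<t ∷ _) → y≮t y<t })) ⟨
    pairTerm (shiftˡ H) (t ∷ U) T + pairTerm H U T ∎

pairCount-∷ : ∀ H U t τ →
  pairCount H U (t ∷ τ) ≡ firstPivotTerm H U t τ + (pairCount (shiftˡ H) (t ∷ U) τ + pairCount H U τ)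
pairCount-∷ H U t τ = trans (∑-splits-∷ t τ (pairTerm H U)) (cong₂ _+_
  (cong (𝟙 (All.all? (t <?_) U) *_) (ℤ.+-identityʳ _))
  (trans (∑-cong (splits τ) (pairTerm-consˡ H U t)) (∑-+ (splits τ) (pairTerm (shiftˡ H) (t ∷ U)) (pairTerm H U))))

ssfCount≡pairCount : ∀ H U τ → ssfCount H U τ ≡ pairCount H U τ
ssfCount≡pairCount H U []      = refl
ssfCount≡pairCount H U (t ∷ τ) = begin
  ssfCount H U (t ∷ τ)
    ≡⟨ ssfCount-∷ H U t τ ⟩
  firstPivotTerm H U t τ + (ssfCount (shiftˡ H) (t ∷ U) τ + ssfCount H U τ)
    ≡⟨ cong (_+_ (firstPivotTerm H U t τ))
            (cong₂ _+_ (ssfCount≡pairCount (shiftˡ H) (t ∷ U) τ) (ssfCount≡pairCount H U τ)) ⟩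
  firstPivotTerm H U t τ + (pairCount (shiftˡ H) (t ∷ U) τ + pairCount H U τ)
    ≡⟨ pairCount-∷ H U t τ ⟨
  pairCount H U (t ∷ τ) ∎
  where open ≡-Reasoning

-- Evaluating the binomial sums

Δˡ Δʳ : (ℕ → ℕ → ℤ) → ℕ → ℕ → ℤ
Δˡ H i l = H (suc i) l + H i l
Δʳ H i l = H i (suc l) + H i l

pairSum-cong : ∀ {H H′} → (∀ i l → H i l ≡ H′ i l) → ∀ A B → pairSum H A B ≡ pairSum H′ A B
pairSum-cong H≗H′ A B = ∑-cong (sublists A) (λ s → ∑-cong (sublists B) (λ t → H≗H′ (length s) (length t)))

pairSum-+ : ∀ H H′ A B → pairSum (λ i l → H i l + H′ i l) A B ≡ pairSum H A B + pairSum H′ A B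
pairSum-+ H H′ A B = trans (∑-cong (sublists A) (λ s → ∑-+ (sublists B) _ _)) (∑-+ (sublists A) _ _)

pairSum-Δˡ : ∀ H x A B → pairSum H (x ∷ A) B ≡ pairSum (Δˡ H) A B
pairSum-Δˡ H x A B = trans (pairSum-∷ˡ H x A B) (sym (pairSum-+ (shiftˡ H) H A B))

pairSum-Δʳ : ∀ H A y B → pairSum H A (y ∷ B) ≡ pairSum (Δʳ H) A B
pairSum-Δʳ H A y B = ∑-cong (sublists A) (λ s →
  trans (∑-sublists-∷ y B (λ t → H (length s) (length t))) (sym (∑-+ (sublists B) _ _)))

pairSum-[] : ∀ H → pairSum H [] [] ≡ H 0 0
pairSum-[] H = trans (ℤ.+-identityʳ _) (ℤ.+-identityʳ _)

atOrigin : (ℕ → ℤ) → ℕ → ℕ → ℤ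
atOrigin c i l = 𝟙 (i ℕ.+ l ℕ.≟ 0) * c l

pairSum-atOrigin : ∀ c A B → pairSum (atOrigin c) A B ≡ c 0
pairSum-atOrigin c (x ∷ A) B =
  trans (pairSum-Δˡ (atOrigin c) x A B) (trans (pairSum-cong absorb A B) (pairSum-atOrigin c A B))
  where
  absorb : ∀ i l → Δˡ (atOrigin c) i l ≡ atOrigin c i l
  absorb i l = ℤ.+-identityˡ (atOrigin c i l)
pairSum-atOrigin c [] (y ∷ B) =
  trans (pairSum-Δʳ (atOrigin c) [] y B) (trans (pairSum-cong absorb [] B) (pairSum-atOrigin c [] B))
  where
  absorb : ∀ i l → Δʳ (atOrigin c) i l ≡ atOrigin c i l
  absorb i l = trans (cong (λ z → z * c (suc l) + atOrigin c i l)
                           (𝟙-no (i ℕ.+ suc l ℕ.≟ 0) (λ eq → ℕ.1+n≢0 (trans (sym (ℕ.+-suc i l)) eq))))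
                     (ℤ.+-identityˡ (atOrigin c i l))
pairSum-atOrigin c [] [] = trans (pairSum-[] (atOrigin c)) (ℤ.*-identityˡ (c 0))

private
  +1+a-1≡a : ∀ a → + 1 + a - + 1 ≡ a
  +1+a-1≡a = solve-∀
  +1+a-k≡a-k+1 : ∀ a k → + 1 + a - k ≡ a - k + + 1
  +1+a-k≡a-k+1 = solve-∀
  a-k≡+1+a-k-1 : ∀ a k → a - k ≡ + 1 + a - k - + 1
  a-k≡+1+a-k-1 = solve-∀
  a-k-1≡a-[k+1] : ∀ a k → a - k - + 1 ≡ a - (k + + 1)
  a-k-1≡a-[k+1] = solve-∀
  a-k+1≡a-[k-1] : ∀ a k → a - k + + 1 ≡ a - (k - + 1)
  a-k+1≡a-[k-1] = solve-∀
  +1+a-k≡a-[k-1] : ∀ a k → + 1 + a - k ≡ a - (k - + 1)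
  +1+a-k≡a-[k-1] = solve-∀

negOnePow-+1 : ∀ e → negOnePow (e + + 1) ≡ - negOnePow e
negOnePow-+1 (+ n)        = cong negOnePowℕ (ℕ.+-comm n 1)
negOnePow-+1 -[1+ zero ]  = refl
negOnePow-+1 -[1+ suc n ] = sym (ℤ.neg-involutive (negOnePowℕ (suc n)))

negOnePow-−1 : ∀ e → negOnePow (e - + 1) ≡ - negOnePow e
negOnePow-−1 e = begin
  negOnePow (e - + 1)          ≡⟨ ℤ.neg-involutive _ ⟨
  - - negOnePow (e - + 1)      ≡⟨ cong -_ (negOnePow-+1 (e - + 1)) ⟨
  - negOnePow (e - + 1 + + 1)  ≡⟨ cong (λ e′ → - negOnePow e′) (cancel e) ⟩
  - negOnePow e                ∎
  where
  open ≡-Reasoning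
  cancel : ∀ e → e - + 1 + + 1 ≡ e
  cancel = solve-∀

binomℤ-pascal : ∀ n r → binomℤ (+ suc n) r ≡ binomℤ (+ n) r + binomℤ (+ n) (r - + 1)
binomℤ-pascal n (+ zero)  = refl
binomℤ-pascal n (+ suc r) = begin
  + (suc n C suc r)                             ≡⟨ cong +_ (nCk+nC[k+1]≡[n+1]C[k+1] n r) ⟨
  + (n C r ℕ.+ n C suc r)                       ≡⟨ cong +_ (ℕ.+-comm (n C r) (n C suc r)) ⟩
  + (n C suc r) + + (n C r)                     ≡⟨ cong (λ r′ → + (n C suc r) + binomℤ (+ n) r′) (+1+a-1≡a (+ r)) ⟨
  + (n C suc r) + binomℤ (+ n) (+ suc r - + 1)  ∎
  where open ≡-Reasoning
binomℤ-pascal n -[1+ r ]  = refl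

binomℤ-0-≢ : ∀ {r} → r ≢ + 0 → binomℤ (+ 0) r ≡ + 0
binomℤ-0-≢ {+ zero}   r≢0 = ⊥-elim (r≢0 refl)
binomℤ-0-≢ {+ suc n}  _   = refl
binomℤ-0-≢ { -[1+ n ]} _  = refl

signedBinom : ℤ → ℤ → ℤ → ℤ
signedBinom e a r = negOnePow e * binomℤ a r

signedBinom-cong : ∀ {e e′ a a′ r r′} → e ≡ e′ → a ≡ a′ → r ≡ r′ → signedBinom e a r ≡ signedBinom e′ a′ r′
signedBinom-cong refl refl refl = refl

signedBinom-pascalˡ : ∀ n e r →
  signedBinom (e + + 1) (+ suc n) r + signedBinom e (+ n) r ≡ signedBinom (e - + 1) (+ n) (r - + 1)
signedBinom-pascalˡ n e r = begin
  negOnePow (e + + 1) * binomℤ (+ suc n) r + σ * binomℤ (+ n) r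
    ≡⟨ cong₂ (λ σ′ b → σ′ * b + σ * binomℤ (+ n) r) (negOnePow-+1 e) (binomℤ-pascal n r) ⟩
  - σ * (binomℤ (+ n) r + binomℤ (+ n) (r - + 1)) + σ * binomℤ (+ n) r
    ≡⟨ ring σ (binomℤ (+ n) r) (binomℤ (+ n) (r - + 1)) ⟩
  - σ * binomℤ (+ n) (r - + 1)
    ≡⟨ cong (_* binomℤ (+ n) (r - + 1)) (negOnePow-−1 e) ⟨
  negOnePow (e - + 1) * binomℤ (+ n) (r - + 1) ∎
  where
  open ≡-Reasoning
  σ = negOnePow e
  ring : ∀ σ p q → - σ * (p + q) + σ * p ≡ - σ * q
  ring = solve-∀

signedBinom-pascalʳ : ∀ n e r →
  signedBinom (e + + 1) (+ suc n) r + signedBinom e (+ n) (r - + 1) ≡ signedBinom (e + + 1) (+ n) r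
signedBinom-pascalʳ n e r = begin
  negOnePow (e + + 1) * binomℤ (+ suc n) r + σ * binomℤ (+ n) (r - + 1)
    ≡⟨ cong₂ (λ σ′ b → σ′ * b + σ * binomℤ (+ n) (r - + 1)) (negOnePow-+1 e) (binomℤ-pascal n r) ⟩
  - σ * (binomℤ (+ n) r + binomℤ (+ n) (r - + 1)) + σ * binomℤ (+ n) (r - + 1)
    ≡⟨ ring σ (binomℤ (+ n) r) (binomℤ (+ n) (r - + 1)) ⟩
  - σ * binomℤ (+ n) r
    ≡⟨ cong (_* binomℤ (+ n) r) (negOnePow-+1 e) ⟨
  negOnePow (e + + 1) * binomℤ (+ n) r ∎
  where
  open ≡-Reasoning
  σ = negOnePow e
  ring : ∀ σ p q → - σ * (p + q) + σ * q ≡ - σ * p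
  ring = solve-∀

𝟙-≟-cong : ∀ {a b c d} → a - b ≡ c - d → 𝟙 (a ℤ.≟ b) ≡ 𝟙 (c ℤ.≟ d)
𝟙-≟-cong {a} {b} {c} {d} eq = 𝟙-⇔ (a ℤ.≟ b) (c ℤ.≟ d)
  (λ a≡b → ℤ.i-j≡0⇒i≡j c d (trans (sym eq) (ℤ.i≡j⇒i-j≡0 a≡b)))
  (λ c≡d → ℤ.i-j≡0⇒i≡j a b (trans eq (ℤ.i≡j⇒i-j≡0 c≡d)))

𝟙-≤?-cong : ∀ a b c d → a - b ≡ c - d → 𝟙 (a ℤ.≤? b) ≡ 𝟙 (c ℤ.≤? d)
𝟙-≤?-cong a b c d eq = 𝟙-⇔ (a ℤ.≤? b) (c ℤ.≤? d)
  (λ a≤b → ℤ.i-j≤0⇒i≤j (subst (ℤ._≤ + 0) eq (ℤ.i≤j⇒i-j≤0 a≤b)))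
  (λ c≤d → ℤ.i-j≤0⇒i≤j (subst (ℤ._≤ + 0) (sym eq) (ℤ.i≤j⇒i-j≤0 c≤d)))

𝟙-≤?-split : ∀ k z → 𝟙 (k ℤ.≤? z) ≡ 𝟙 (k + + 1 ℤ.≤? z) + 𝟙 (k ℤ.≟ z)
𝟙-≤?-split k z with k ℤ.≤? z | k ℤ.≟ z
... | yes k≤z | yes refl = sym (cong (_+ + 1) (𝟙-no (k + + 1 ℤ.≤? k) k+1≰k))
  where
  k+1≰k : ¬ (k + + 1 ℤ.≤ k)
  k+1≰k k+1≤k = ℤ.<-irrefl refl (ℤ.suc[i]≤j⇒i<j (subst (ℤ._≤ k) (ℤ.+-comm k (+ 1)) k+1≤k))
... | yes k≤z | no k≢z   = sym (cong (_+ + 0) (𝟙-yes (k + + 1 ℤ.≤? z) k+1≤z))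
  where
  k+1≤z : k + + 1 ℤ.≤ z
  k+1≤z = subst (ℤ._≤ z) (ℤ.+-comm (+ 1) k) (ℤ.i<j⇒suc[i]≤j (ℤ.≤∧≢⇒< k≤z k≢z))
... | no k≰z  | yes refl = ⊥-elim (k≰z ℤ.≤-refl)
... | no k≰z  | no _     = sym (cong (_+ + 0) (𝟙-no (k + + 1 ℤ.≤? z) k+1≰z))
  where
  k+1≰z : ¬ (k + + 1 ℤ.≤ z)
  k+1≰z k+1≤z = k≰z (ℤ.≤-trans (subst (k ℤ.≤_) (ℤ.+-comm (+ 1) k) (ℤ.i≤suc[i] k)) k+1≤z)

exactWeight : ℤ → ℕ → ℕ → ℤ
exactWeight k i l = signedBinom (+ (i ℕ.+ l) - k) (+ (i ℕ.+ l)) (+ l - k)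

Δˡ-exactWeight : ∀ k i l → Δˡ (exactWeight k) i l ≡ exactWeight (k + + 1) i l
Δˡ-exactWeight k i l = begin
  signedBinom (+ suc n - k) (+ suc n) (+ l - k) + exactWeight k i l
    ≡⟨ cong (_+ exactWeight k i l) (signedBinom-cong (+1+a-k≡a-k+1 (+ n) k) refl refl) ⟩
  signedBinom (+ n - k + + 1) (+ suc n) (+ l - k) + signedBinom (+ n - k) (+ n) (+ l - k)
    ≡⟨ signedBinom-pascalˡ n (+ n - k) (+ l - k) ⟩
  signedBinom (+ n - k - + 1) (+ n) (+ l - k - + 1)
    ≡⟨ signedBinom-cong (a-k-1≡a-[k+1] (+ n) k) refl (a-k-1≡a-[k+1] (+ l) k) ⟩
  exactWeight (k + + 1) i l ∎
  where
  open ≡-Reasoning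
  n = i ℕ.+ l

Δʳ-exactWeight : ∀ k i l → Δʳ (exactWeight k) i l ≡ exactWeight (k - + 1) i l
Δʳ-exactWeight k i l = begin
  signedBinom (+ (i ℕ.+ suc l) - k) (+ (i ℕ.+ suc l)) (+ suc l - k) + exactWeight k i l
    ≡⟨ cong (λ m → signedBinom (+ m - k) (+ m) (+ suc l - k) + exactWeight k i l) (ℕ.+-suc i l) ⟩
  signedBinom (+ suc n - k) (+ suc n) (+ suc l - k) + signedBinom (+ n - k) (+ n) (+ l - k)
    ≡⟨ cong₂ _+_ (signedBinom-cong (+1+a-k≡a-k+1 (+ n) k) refl refl)
                 (signedBinom-cong (refl {x = + n - k}) refl (a-k≡+1+a-k-1 (+ l) k)) ⟩
  signedBinom (+ n - k + + 1) (+ suc n) (+ suc l - k) + signedBinom (+ n - k) (+ n) (+ suc l - k - + 1)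
    ≡⟨ signedBinom-pascalʳ n (+ n - k) (+ suc l - k) ⟩
  signedBinom (+ n - k + + 1) (+ n) (+ suc l - k)
    ≡⟨ signedBinom-cong (a-k+1≡a-[k-1] (+ n) k) refl (+1+a-k≡a-[k-1] (+ l) k) ⟩
  exactWeight (k - + 1) i l ∎
  where
  open ≡-Reasoning
  n = i ℕ.+ l

exactWeight-0-0 : ∀ k → exactWeight k 0 0 ≡ 𝟙 (+ 0 ℤ.≟ k)
exactWeight-0-0 k with k ℤ.≟ + 0
... | yes refl = refl
... | no k≢0   = begin
  negOnePow (+ 0 - k) * binomℤ (+ 0) (+ 0 - k)  ≡⟨ cong (negOnePow (+ 0 - k) *_) (binomℤ-0-≢ -k≢0) ⟩
  negOnePow (+ 0 - k) * + 0                    ≡⟨ ℤ.*-zeroʳ (negOnePow (+ 0 - k)) ⟩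
  + 0                                          ≡⟨ 𝟙-no (+ 0 ℤ.≟ k) (λ 0≡k → k≢0 (sym 0≡k)) ⟨
  𝟙 (+ 0 ℤ.≟ k)                                ∎
  where
  open ≡-Reasoning
  -k≢0 : + 0 - k ≢ + 0
  -k≢0 -k≡0 = k≢0 (sym (ℤ.i-j≡0⇒i≡j (+ 0) k -k≡0))

pairSum-exactWeight : ∀ A B k → pairSum (exactWeight k) A B ≡ 𝟙 (+ length B - + length A ℤ.≟ k)
pairSum-exactWeight (x ∷ A) B k = begin
  pairSum (exactWeight k) (x ∷ A) B          ≡⟨ pairSum-Δˡ (exactWeight k) x A B ⟩
  pairSum (Δˡ (exactWeight k)) A B           ≡⟨ pairSum-cong (Δˡ-exactWeight k) A B ⟩
  pairSum (exactWeight (k + + 1)) A B        ≡⟨ pairSum-exactWeight A B (k + + 1) ⟩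
  𝟙 (+ length B - + length A ℤ.≟ k + + 1)    ≡⟨ 𝟙-≟-cong (ring (+ length B) (+ length A) k) ⟩
  𝟙 (+ length B - + suc (length A) ℤ.≟ k)    ∎
  where
  open ≡-Reasoning
  ring : ∀ b a k → b - a - (k + + 1) ≡ b - (+ 1 + a) - k
  ring = solve-∀
pairSum-exactWeight [] (y ∷ B) k = begin
  pairSum (exactWeight k) [] (y ∷ B)         ≡⟨ pairSum-Δʳ (exactWeight k) [] y B ⟩
  pairSum (Δʳ (exactWeight k)) [] B          ≡⟨ pairSum-cong (Δʳ-exactWeight k) [] B ⟩
  pairSum (exactWeight (k - + 1)) [] B       ≡⟨ pairSum-exactWeight [] B (k - + 1) ⟩
  𝟙 (+ length B - + 0 ℤ.≟ k - + 1)           ≡⟨ 𝟙-≟-cong (ring (+ length B) k) ⟩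
  𝟙 (+ suc (length B) - + 0 ℤ.≟ k)           ∎
  where
  open ≡-Reasoning
  ring : ∀ b k → b - + 0 - (k - + 1) ≡ + 1 + b - + 0 - k
  ring = solve-∀
pairSum-exactWeight [] [] k = trans (pairSum-[] (exactWeight k)) (exactWeight-0-0 k)

-- For  n = 0  the binomial has upper index −1, where  binomℤ  is 0.
atLeastTerm : ℤ → ℕ → ℕ → ℤ
atLeastTerm k n l = signedBinom (+ n - k) (+ n - + 1) (+ l - k)

atLeastWeight : ℤ → ℕ → ℕ → ℤ
atLeastWeight k i l = atLeastTerm k (i ℕ.+ l) l

atLeastTerm-0 : ∀ k l → atLeastTerm k 0 l ≡ + 0
atLeastTerm-0 k l = ℤ.*-zeroʳ (negOnePow (+ 0 - k))

step-at-0 : ∀ {a b c} → b ≡ + 0 → c ≡ + 0 → a + b ≡ c + + 1 * a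
step-at-0 {a} refl refl = ring a
  where
  ring : ∀ a → a + + 0 ≡ + 0 + + 1 * a
  ring = solve-∀

atLeastTerm-stepˡ : ∀ k n l →
  atLeastTerm k (suc n) l + atLeastTerm k n l ≡ atLeastTerm (k + + 1) n l + 𝟙 (n ℕ.≟ 0) * atLeastTerm k 1 l
atLeastTerm-stepˡ k zero    l = step-at-0 (atLeastTerm-0 k l) (atLeastTerm-0 (k + + 1) l)
atLeastTerm-stepˡ k (suc m) l = begin
  signedBinom (+ suc (suc m) - k) (+ suc (suc m) - + 1) (+ l - k) + signedBinom (+ suc m - k) (+ suc m - + 1) (+ l - k)
    ≡⟨ cong₂ _+_ (signedBinom-cong (+1+a-k≡a-k+1 (+ suc m) k) (+1+a-1≡a (+ suc m)) refl)
                 (signedBinom-cong (refl {x = + suc m - k}) (+1+a-1≡a (+ m)) refl) ⟩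
  signedBinom (+ suc m - k + + 1) (+ suc m) (+ l - k) + signedBinom (+ suc m - k) (+ m) (+ l - k)
    ≡⟨ signedBinom-pascalˡ m (+ suc m - k) (+ l - k) ⟩
  signedBinom (+ suc m - k - + 1) (+ m) (+ l - k - + 1)
    ≡⟨ signedBinom-cong (a-k-1≡a-[k+1] (+ suc m) k) (sym (+1+a-1≡a (+ m))) (a-k-1≡a-[k+1] (+ l) k) ⟩
  atLeastTerm (k + + 1) (suc m) l
    ≡⟨ ℤ.+-identityʳ _ ⟨
  atLeastTerm (k + + 1) (suc m) l + + 0 * atLeastTerm k 1 l ∎
  where open ≡-Reasoning

atLeastTerm-stepʳ : ∀ k n l →
  atLeastTerm k (suc n) (suc l) + atLeastTerm k n l ≡ atLeastTerm (k - + 1) n l + 𝟙 (n ℕ.≟ 0) * atLeastTerm k 1 (suc l)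
atLeastTerm-stepʳ k zero    l = step-at-0 (atLeastTerm-0 k l) (atLeastTerm-0 (k - + 1) l)
atLeastTerm-stepʳ k (suc m) l = begin
  signedBinom (+ suc (suc m) - k) (+ suc (suc m) - + 1) (+ suc l - k) + signedBinom (+ suc m - k) (+ suc m - + 1) (+ l - k)
    ≡⟨ cong₂ _+_ (signedBinom-cong (+1+a-k≡a-k+1 (+ suc m) k) (+1+a-1≡a (+ suc m)) refl)
                 (signedBinom-cong (refl {x = + suc m - k}) (+1+a-1≡a (+ m)) (a-k≡+1+a-k-1 (+ l) k)) ⟩
  signedBinom (+ suc m - k + + 1) (+ suc m) (+ suc l - k) + signedBinom (+ suc m - k) (+ m) (+ suc l - k - + 1)
    ≡⟨ signedBinom-pascalʳ m (+ suc m - k) (+ suc l - k) ⟩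
  signedBinom (+ suc m - k + + 1) (+ m) (+ suc l - k)
    ≡⟨ signedBinom-cong (a-k+1≡a-[k-1] (+ suc m) k) (sym (+1+a-1≡a (+ m))) (+1+a-k≡a-[k-1] (+ l) k) ⟩
  atLeastTerm (k - + 1) (suc m) l
    ≡⟨ ℤ.+-identityʳ _ ⟨
  atLeastTerm (k - + 1) (suc m) l + + 0 * atLeastTerm k 1 (suc l) ∎
  where open ≡-Reasoning

Δˡ-atLeastWeight : ∀ k i l →
  Δˡ (atLeastWeight k) i l ≡ atLeastWeight (k + + 1) i l + atOrigin (atLeastTerm k 1) i l
Δˡ-atLeastWeight k i l = atLeastTerm-stepˡ k (i ℕ.+ l) l

Δʳ-atLeastWeight : ∀ k i l →
  Δʳ (atLeastWeight k) i l ≡ atLeastWeight (k - + 1) i l + atOrigin (λ l → atLeastTerm k 1 (suc l)) i l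
Δʳ-atLeastWeight k i l =
  trans (cong (λ n → atLeastTerm k n (suc l) + atLeastWeight k i l) (ℕ.+-suc i l)) (atLeastTerm-stepʳ k (i ℕ.+ l) l)

atLeastTerm-1-0 : ∀ k → atLeastTerm k 1 0 ≡ - 𝟙 (k ℤ.≟ + 0)
atLeastTerm-1-0 k with k ℤ.≟ + 0
... | yes refl = refl
... | no k≢0   = trans (cong (negOnePow (+ 1 - k) *_) (binomℤ-0-≢ -k≢0)) (ℤ.*-zeroʳ (negOnePow (+ 1 - k)))
  where
  -k≢0 : + 0 - k ≢ + 0
  -k≢0 -k≡0 = k≢0 (sym (ℤ.i-j≡0⇒i≡j (+ 0) k -k≡0))

atLeastTerm-1-1 : ∀ k → atLeastTerm k 1 1 ≡ 𝟙 (k ℤ.≟ + 1)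
atLeastTerm-1-1 k with k ℤ.≟ + 1
... | yes refl = refl
... | no k≢1   = trans (cong (negOnePow (+ 1 - k) *_) (binomℤ-0-≢ 1-k≢0)) (ℤ.*-zeroʳ (negOnePow (+ 1 - k)))
  where
  1-k≢0 : + 1 - k ≢ + 0
  1-k≢0 1-k≡0 = k≢1 (sym (ℤ.i-j≡0⇒i≡j (+ 1) k 1-k≡0))

pairSum-atLeastWeight : ∀ A B k →
  pairSum (atLeastWeight k) A B ≡ 𝟙 (k ℤ.≤? + length B - + length A) - 𝟙 (k ℤ.≤? + 0)
pairSum-atLeastWeight (x ∷ A) B k = begin
  pairSum (atLeastWeight k) (x ∷ A) B
    ≡⟨ pairSum-Δˡ (atLeastWeight k) x A B ⟩
  pairSum (Δˡ (atLeastWeight k)) A B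
    ≡⟨ pairSum-cong (Δˡ-atLeastWeight k) A B ⟩
  pairSum (λ i l → atLeastWeight (k + + 1) i l + atOrigin (atLeastTerm k 1) i l) A B
    ≡⟨ pairSum-+ (atLeastWeight (k + + 1)) (atOrigin (atLeastTerm k 1)) A B ⟩
  pairSum (atLeastWeight (k + + 1)) A B + pairSum (atOrigin (atLeastTerm k 1)) A B
    ≡⟨ cong₂ _+_ (pairSum-atLeastWeight A B (k + + 1)) (trans (pairSum-atOrigin (atLeastTerm k 1) A B) (atLeastTerm-1-0 k)) ⟩
  𝟙 (k + + 1 ℤ.≤? z) - 𝟙 (k + + 1 ℤ.≤? + 0) - 𝟙 (k ℤ.≟ + 0)
    ≡⟨ ring (𝟙 (k + + 1 ℤ.≤? z)) (𝟙 (k + + 1 ℤ.≤? + 0)) (𝟙 (k ℤ.≟ + 0)) ⟩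
  𝟙 (k + + 1 ℤ.≤? z) - (𝟙 (k + + 1 ℤ.≤? + 0) + 𝟙 (k ℤ.≟ + 0))
    ≡⟨ cong₂ _-_ (𝟙-≤?-cong k (+ length B - + suc (length A)) (k + + 1) z (shift (+ length B) (+ length A) k))
                 (𝟙-≤?-split k (+ 0)) ⟨
  𝟙 (k ℤ.≤? + length B - + suc (length A)) - 𝟙 (k ℤ.≤? + 0) ∎
  where
  open ≡-Reasoning
  z = + length B - + length A
  ring : ∀ p q r → p - q - r ≡ p - (q + r)
  ring = solve-∀
  shift : ∀ b a k → k - (b - (+ 1 + a)) ≡ k + + 1 - (b - a)
  shift = solve-∀
pairSum-atLeastWeight [] (y ∷ B) k = begin
  pairSum (atLeastWeight k) [] (y ∷ B)
    ≡⟨ pairSum-Δʳ (atLeastWeight k) [] y B ⟩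
  pairSum (Δʳ (atLeastWeight k)) [] B
    ≡⟨ pairSum-cong (Δʳ-atLeastWeight k) [] B ⟩
  pairSum (λ i l → atLeastWeight (k - + 1) i l + atOrigin c i l) [] B
    ≡⟨ pairSum-+ (atLeastWeight (k - + 1)) (atOrigin c) [] B ⟩
  pairSum (atLeastWeight (k - + 1)) [] B + pairSum (atOrigin c) [] B
    ≡⟨ cong₂ _+_ (pairSum-atLeastWeight [] B (k - + 1)) (trans (pairSum-atOrigin c [] B) (atLeastTerm-1-1 k)) ⟩
  𝟙 (k - + 1 ℤ.≤? + length B - + 0) - 𝟙 (k - + 1 ℤ.≤? + 0) + 𝟙 (k ℤ.≟ + 1)
    ≡⟨ cong (λ q → 𝟙 (k - + 1 ℤ.≤? + length B - + 0) - q + 𝟙 (k ℤ.≟ + 1)) k-1≤0 ⟩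
  𝟙 (k - + 1 ℤ.≤? + length B - + 0) - (𝟙 (k ℤ.≤? + 0) + 𝟙 (k ℤ.≟ + 1)) + 𝟙 (k ℤ.≟ + 1)
    ≡⟨ ring (𝟙 (k - + 1 ℤ.≤? + length B - + 0)) (𝟙 (k ℤ.≤? + 0)) (𝟙 (k ℤ.≟ + 1)) ⟩
  𝟙 (k - + 1 ℤ.≤? + length B - + 0) - 𝟙 (k ℤ.≤? + 0)
    ≡⟨ cong (_- 𝟙 (k ℤ.≤? + 0))
            (𝟙-≤?-cong (k - + 1) (+ length B - + 0) k (+ suc (length B) - + 0) (shift (+ length B) k)) ⟩
  𝟙 (k ℤ.≤? + suc (length B) - + 0) - 𝟙 (k ℤ.≤? + 0) ∎
  where
  open ≡-Reasoning
  c = λ l → atLeastTerm k 1 (suc l)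
  ring : ∀ p q r → p - (q + r) + r ≡ p - q
  ring = solve-∀
  shift : ∀ b k → k - + 1 - (b - + 0) ≡ k - (+ 1 + b - + 0)
  shift = solve-∀
  cancel : ∀ k → k - + 1 - + 0 ≡ k - + 1
  cancel = solve-∀
  k-1≤0 : 𝟙 (k - + 1 ℤ.≤? + 0) ≡ 𝟙 (k ℤ.≤? + 0) + 𝟙 (k ℤ.≟ + 1)
  k-1≤0 = trans (𝟙-≤?-split (k - + 1) (+ 0))
                (cong₂ _+_ (𝟙-≤?-cong (k - + 1 + + 1) (+ 0) k (+ 0) (cancel′ k)) (𝟙-≟-cong (cancel k)))
    where
    cancel′ : ∀ k → k - + 1 + + 1 - + 0 ≡ k - + 0
    cancel′ = solve-∀
pairSum-atLeastWeight [] [] k = begin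
  pairSum (atLeastWeight k) [] []         ≡⟨ pairSum-[] (atLeastWeight k) ⟩
  negOnePow (+ 0 - k) * + 0               ≡⟨ ℤ.*-zeroʳ (negOnePow (+ 0 - k)) ⟩
  + 0                                     ≡⟨ ℤ.+-inverseʳ (𝟙 (k ℤ.≤? + 0)) ⟨
  𝟙 (k ℤ.≤? + 0) - 𝟙 (k ℤ.≤? + 0)         ∎
  where open ≡-Reasoning

-- The expansions

sumPermsUpTo-cong : ∀ N {f g : List ℕ → ℤ} → (∀ π → IsPerm π → f π ≡ g π) →
                    sumPermsUpTo N f ≡ sumPermsUpTo N g
sumPermsUpTo-cong N f≗g = cong sumℤ (List.map-cong (λ m → cong sumℤ (List.map-cong-local
  (All.map (λ {π} → f≗g π) (AllP.all-filter isPerm? (words m (range1 m)))))) (upTo (suc N)))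

ssfWeight-cong : ∀ {w w′} → (∀ i l → w i l ≡ w′ i l) → ∀ π → ssfWeight w π ≡ ssfWeight w′ π
ssfWeight-cong w≗w′ π =
  ∑-cong (splits π) (λ T → cong (𝟙 (isSSFSplit? T) *_) (w≗w′ (length (left T)) (length (right T))))

sumPermsUpTo-ssfWeight : ∀ w τ N → Unique τ → length τ ℕ.≤ N →
  sumPermsUpTo N (λ π → ssfWeight w π * + occ π τ) ≡ ∑[ T ∈ splits τ ] pairSum w (larger T) (smaller T)
sumPermsUpTo-ssfWeight w τ N τ! |τ|≤N = begin
  sumPermsUpTo N (λ π → ssfWeight w π * + occ π τ)   ≡⟨ sumPermsUpTo-occ (ssfWeight w) τ N τ! |τ|≤N ⟩
  ∑[ s ∈ sublists τ ] ssfWeight w (st s)             ≡⟨ ∑-cong (sublists τ) (ssfWeight-st w) ⟩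
  ∑[ s ∈ sublists τ ] ssfWeight w s                  ≡⟨ ∑-cong (sublists τ) (λ s → ∑-cong (splits s) no-context) ⟨
  ∑[ s ∈ sublists τ ] ∑ (splits s) (ssfTerm w [])    ≡⟨ ssfCount≡pairCount w [] τ ⟩
  ∑ (splits τ) (pairTerm w [])                       ≡⟨ ∑-cong (splits τ) (λ T → ℤ.*-identityˡ _) ⟩
  ∑[ T ∈ splits τ ] pairSum w (larger T) (smaller T) ∎
  where
  open ≡-Reasoning
  no-context : ∀ T → ssfTerm w [] T ≡ 𝟙 (isSSFSplit? T) * w (length (left T)) (length (right T))
  no-context T = cong (_* w (length (left T)) (length (right T)))
    (trans (𝟙-× (All.all? (pivot T <?_) []) (isSSFSplit? T)) (ℤ.*-identityˡ (𝟙 (isSSFSplit? T))))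

∑-splits-excess : ∀ τ → IsPerm τ → (g : ℤ → ℤ) →
  ∑[ T ∈ splits τ ] g (+ length (smaller T) - + length (larger T)) ≡
  ∑[ T ∈ splits τ ] g (+ pivot T - + suc (length (left T)))
∑-splits-excess τ τ-perm g =
  ∑-splits-cong τ (λ L y R L++y∷R≡τ → cong g (sym (pivot-excess L y R (subst IsPerm (sym L++y∷R≡τ) τ-perm))))

coeffExcK≡ssfWeight : ∀ k π → IsPerm π → coeffExcK k π ≡ ssfWeight (exactWeight k) π
coeffExcK≡ssfWeight k π π-perm =
  trans (ssfSum≡ssfWeight (λ n → negOnePow (+ n - k - + 1)) (λ n x → binomℤ (+ n - + 1) (+ x - k - + 1)) π π-perm)
        (ssfWeight-cong reindex π)
  where
  shift : ∀ a k → + 1 + a - k - + 1 ≡ a - k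
  shift = solve-∀
  reindex : ∀ i l → signedBinom (+ (i ℕ.+ suc l) - k - + 1) (+ (i ℕ.+ suc l) - + 1) (+ suc l - k - + 1) ≡
                    exactWeight k i l
  reindex i l = trans (cong (λ n → signedBinom (+ n - k - + 1) (+ n - + 1) (+ suc l - k - + 1)) (ℕ.+-suc i l))
                      (signedBinom-cong (shift (+ (i ℕ.+ l)) k) (+1+a-1≡a (+ (i ℕ.+ l))) (shift (+ l) k))

excK-expansion : ∀ (k : ℤ) (τ : List ℕ) → IsPerm τ → (N : ℕ) → length τ ℕ.≤ N →
                 + excK k τ ≡ sumPermsUpTo N (λ π → coeffExcK k π *ℤ + occ π τ)
excK-expansion k τ τ-perm@(τ! , _) N |τ|≤N = sym (begin
  sumPermsUpTo N (λ π → coeffExcK k π * + occ π τ)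
    ≡⟨ sumPermsUpTo-cong N (λ π π-perm → cong (_* + occ π τ) (coeffExcK≡ssfWeight k π π-perm)) ⟩
  sumPermsUpTo N (λ π → ssfWeight (exactWeight k) π * + occ π τ)
    ≡⟨ sumPermsUpTo-ssfWeight (exactWeight k) τ N τ! |τ|≤N ⟩
  ∑[ T ∈ splits τ ] pairSum (exactWeight k) (larger T) (smaller T)
    ≡⟨ ∑-cong (splits τ) (λ T → pairSum-exactWeight (larger T) (smaller T) k) ⟩
  ∑[ T ∈ splits τ ] 𝟙 (+ length (smaller T) - + length (larger T) ℤ.≟ k)
    ≡⟨ ∑-splits-excess τ τ-perm (λ d → 𝟙 (d ℤ.≟ k)) ⟩
  ∑[ T ∈ splits τ ] 𝟙 (+ pivot T - + suc (length (left T)) ℤ.≟ k)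
    ≡⟨ length-filter-indexed τ (λ p → + proj₂ p - + proj₁ p ℤ.≟ k) ⟨
  + excK k τ ∎)
  where open ≡-Reasoning

fix≡excK-0 : ∀ τ → + fix τ ≡ + excK (+ 0) τ
fix≡excK-0 τ = begin
  + fix τ                                               ≡⟨ length-filter≡∑𝟙 _ (indexed τ) ⟩
  ∑[ p ∈ indexed τ ] 𝟙 (proj₂ p ℕ.≟ proj₁ p)             ≡⟨ ∑-cong (indexed τ) fixed⇔excess-0 ⟩
  ∑[ p ∈ indexed τ ] 𝟙 (+ proj₂ p - + proj₁ p ℤ.≟ + 0)  ≡⟨ length-filter≡∑𝟙 _ (indexed τ) ⟨
  + excK (+ 0) τ                                        ∎
  where
  open ≡-Reasoning
  fixed⇔excess-0 : ∀ ((j , y) : ℕ × ℕ) → 𝟙 (y ℕ.≟ j) ≡ 𝟙 (+ y - + j ℤ.≟ + 0)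
  fixed⇔excess-0 (j , y) = 𝟙-⇔ (y ℕ.≟ j) (+ y - + j ℤ.≟ + 0)
    (λ y≡j → ℤ.i≡j⇒i-j≡0 (cong +_ y≡j)) (λ y-j≡0 → ℤ.+-injective (ℤ.i-j≡0⇒i≡j (+ y) (+ j) y-j≡0))

coeffExcK-0≡coeffFix : ∀ π → coeffExcK (+ 0) π ≡ coeffFix π
coeffExcK-0≡coeffFix π = cong₂ _*_
  (cong (λ n → negOnePow (n - + 1)) (ℤ.+-identityʳ (+ length π)))
  (cong sumℤ (List.map-cong (λ x → cong (λ x′ → binomℤ (+ length π - + 1) (x′ - + 1)) (ℤ.+-identityʳ (+ x)))
                            (SSF π)))

fix-expansion : ∀ (τ : List ℕ) → IsPerm τ → (N : ℕ) → length τ ℕ.≤ N →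
                + fix τ ≡ sumPermsUpTo N (λ π → coeffFix π *ℤ + occ π τ)
fix-expansion τ τ-perm N |τ|≤N = begin
  + fix τ
    ≡⟨ fix≡excK-0 τ ⟩
  + excK (+ 0) τ
    ≡⟨ excK-expansion (+ 0) τ τ-perm N |τ|≤N ⟩
  sumPermsUpTo N (λ π → coeffExcK (+ 0) π * + occ π τ)
    ≡⟨ sumPermsUpTo-cong N (λ π _ → cong (_* + occ π τ) (coeffExcK-0≡coeffFix π)) ⟩
  sumPermsUpTo N (λ π → coeffFix π * + occ π τ) ∎
  where open ≡-Reasoning

coeffExc≡ssfWeight : ∀ π → IsPerm π → coeffExc π ≡ ssfWeight (atLeastWeight (+ 1)) π
coeffExc≡ssfWeight π π-perm =
  trans (ssfSum≡ssfWeight (λ n → negOnePow (+ n - + 2)) (λ n x → binomℤ (+ n - + 2) (+ x - + 2)) π π-perm)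
        (ssfWeight-cong reindex π)
  where
  dec : ∀ a → + 1 + a - + 2 ≡ a - + 1
  dec = solve-∀
  reindex : ∀ i l → signedBinom (+ (i ℕ.+ suc l) - + 2) (+ (i ℕ.+ suc l) - + 2) (+ suc l - + 2) ≡
                    atLeastWeight (+ 1) i l
  reindex i l = trans (cong (λ n → signedBinom (+ n - + 2) (+ n - + 2) (+ suc l - + 2)) (ℕ.+-suc i l))
                      (signedBinom-cong (dec (+ (i ℕ.+ l))) (dec (+ (i ℕ.+ l))) (dec (+ l)))

𝟙-1≤?-difference : ∀ j y → 𝟙 (+ 1 ℤ.≤? + y - + j) ≡ 𝟙 (j <? y)
𝟙-1≤?-difference j y = trans (𝟙-≤?-cong (+ 1) (+ y - + j) (+ suc j) (+ y) (ring (+ j) (+ y)))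
                              (𝟙-⇔ (+ suc j ℤ.≤? + y) (j <? y) ℤ.drop‿+≤+ ℤ.+≤+)
  where
  ring : ∀ j y → + 1 - (y - j) ≡ + 1 + j - y
  ring = solve-∀

exc-expansion : ∀ (τ : List ℕ) → IsPerm τ → (N : ℕ) → length τ ℕ.≤ N →
                + exc τ ≡ sumPermsUpTo N (λ π → coeffExc π *ℤ + occ π τ)
exc-expansion τ τ-perm@(τ! , _) N |τ|≤N = sym (begin
  sumPermsUpTo N (λ π → coeffExc π * + occ π τ)
    ≡⟨ sumPermsUpTo-cong N (λ π π-perm → cong (_* + occ π τ) (coeffExc≡ssfWeight π π-perm)) ⟩
  sumPermsUpTo N (λ π → ssfWeight (atLeastWeight (+ 1)) π * + occ π τ)
    ≡⟨ sumPermsUpTo-ssfWeight (atLeastWeight (+ 1)) τ N τ! |τ|≤N ⟩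
  ∑[ T ∈ splits τ ] pairSum (atLeastWeight (+ 1)) (larger T) (smaller T)
    ≡⟨ ∑-cong (splits τ) (λ T → trans (pairSum-atLeastWeight (larger T) (smaller T) (+ 1)) (ℤ.+-identityʳ _)) ⟩
  ∑[ T ∈ splits τ ] 𝟙 (+ 1 ℤ.≤? + length (smaller T) - + length (larger T))
    ≡⟨ ∑-splits-excess τ τ-perm (λ d → 𝟙 (+ 1 ℤ.≤? d)) ⟩
  ∑[ T ∈ splits τ ] 𝟙 (+ 1 ℤ.≤? + pivot T - + suc (length (left T)))
    ≡⟨ ∑-cong (splits τ) (λ T → 𝟙-1≤?-difference (suc (length (left T))) (pivot T)) ⟩
  ∑[ T ∈ splits τ ] 𝟙 (suc (length (left T)) <? pivot T)
    ≡⟨ length-filter-indexed τ (λ p → proj₁ p <? proj₂ p) ⟨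
  + exc τ ∎)
  where open ≡-Reasoning

mainTheorem4 :
    ((k : ℤ) (τ : List ℕ) → IsPerm τ → (N : ℕ) → length τ ≤ N →
      + excK k τ ≡ sumPermsUpTo N (λ π → coeffExcK k π *ℤ + occ π τ))
    × ((τ : List ℕ) → IsPerm τ → (N : ℕ) → length τ ≤ N →
      + fix τ ≡ sumPermsUpTo N (λ π → coeffFix π *ℤ + occ π τ))
    × ((τ : List ℕ) → IsPerm τ → (N : ℕ) → length τ ≤ N →
      + exc τ ≡ sumPermsUpTo N (λ π → coeffExc π *ℤ + occ π τ))
mainTheorem4 = excK-expansion , fix-expansion , exc-expansion
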